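{- Let $\mathbb I$ be the $\mathbb F$-span of $\{B_{a,b,c}: a\oplus b\le_2c\le_2a\odot b,\ p\mid k_b\}$ and let $N=|\{a\in[1,n]: u_a\equiv1\pmod p\}|$. Then the product of any $2N+1$ elements of $\mathbb I$ is the zero matrix. Furthermore, $\mathbb I$ is a nilpotent two-sided ideal of $\mathbb T$ with nilpotency index $n(\mathbb I)=2N+1$, and $\mathbb I\subseteq\mathrm{Rad}(\mathbb T)$.
   Context: Let $n\ge1$ and let $\mathbb U_1,\dots,\mathbb U_n$ be finite sets with $|\mathbb U_a|=u_a\ge2$. Put $\mathbb X=\prod_a\mathbb U_a$, $d=2^n-1$. For $g\in[0,d]$ with binary expansion $g=\sum_{a=1}^n g_{(a)}2^{a-1}$ let $\mathbb P(g)=\{a:g_{(a)}=1\}$, and $R_g=\{(\mathbf u,\mathbf v)\in\mathbb X^2:\mathbf u_a\ne\mathbf v_a\iff a\in\mathbb P(g)\}$ (factorial association scheme); $k_g=|\{\mathbf w:(\mathbf u,\mathbf w)\in R_g\}|$. For $g,h\in[0,d]$: $g\le_2h$ iff $\mathbb P(g)\subseteq\mathbb P(h)$; $g\cup h,g\cap h,g\setminus h$ are the elements whose $\mathbb P$ is the union, intersection, difference; $g\oplus h=(g\setminus h)\cup(h\setminus g)$; $\widetilde g$ has $\mathbb P(\widetilde g)=\{a\in\mathbb P(g):u_a>2\}$; $g\odot h=(g\oplus h)\cup\widetilde{g\cap h}$. $\mathbb F$ is a field of characteristic $p$; "$p\mid m$" means $m\cdot1_{\mathbb F}=0$, "$u_a\equiv1\pmod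 p$" means $u_a\cdot1_{\mathbb F}=1_{\mathbb F}$. $A_g$ is the $\{0,1\}$ adjacency matrix of $R_g$ over $\mathbb F$; fixing $\mathbf x\in\mathbb X$, $E_g^*$ is the diagonal $\{0,1\}$-matrix with $E_g^*(\mathbf u,\mathbf u)=1$ iff $(\mathbf x,\mathbf u)\in R_g$; $\mathbb T$ is the subalgebra of $M_{\mathbb X}(\mathbb F)$ generated by all $A_g,E_g^*$, with Jacobson radical $\mathrm{Rad}(\mathbb T)$. $B_{g,h,i}=\sum_{j:\ g\oplus i\le_2j\le_2h}E_g^*A_jE_i^*$. For a nilpotent ideal $\mathbb I$, $n(\mathbb I)$ is the smallest $h\ge1$ such that any product of $h$ elements of $\mathbb I$ is zero. -}

module Defs where

open import Level using (Level; _⊔_) renaming (suc to lsuc)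
open import Algebra.Bundles using (CommutativeRing)
open import Data.Nat as ℕ using (ℕ; zero; suc; _≤_; _<_; _<ᵇ_)
open import Data.Fin using (Fin; zero; suc)
open import Data.Fin.Properties using () renaming (_≟_ to _≟F_)
open import Data.Fin.Subset using (Subset; _∈_; _∉_; _⊆_; _∪_; _∩_; _─_; ∣_∣)
open import Data.Fin.Subset.Properties using (_⊆?_)
open import Data.Bool using (Bool; true; false; _∧_)
open import Data.Bool.ListAction using (and)
open import Data.List as L using (List; []; _∷_; allFin; concatMap; map; foldr; length; filter)
open import Data.Vec as V using (Vec; []; _∷_; tabulate; lookup)
open import Data.Product using (Σ; _×_; _,_; ∃)
open import Relation.Nullary using (¬_; Dec; yes; no)
open import Relation.Nullary.Decidable using (_×-dec_; _→-dec_; ¬?)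
open import Relation.Unary using (Pred)
open import Relation.Binary.PropositionalEquality using (_≡_)
open import Function using (_⇔_)

record Field c ℓ : Set (lsuc (c ⊔ ℓ)) where
  field
    commutativeRing : CommutativeRing c ℓ
  open CommutativeRing commutativeRing public
  field
    1≉0     : ¬ (1# ≈ 0#)
    inverse : ∀ x → ¬ (x ≈ 0#) → Σ Carrier λ y → (x * y) ≈ 1#

-- The factorial scheme.  U_a = Fin (u a); X = ∏_a U_a.
-- Indices g ∈ [0,d] are represented by their support ℙ(g) : Subset n.

Pt : (n : ℕ) → (Fin n → ℕ) → Set
Pt n u = (a : Fin n) → Fin (u a)

allPt : (n : ℕ) (u : Fin n → ℕ) → List (Pt n u)
allPt zero    u = (λ ()) ∷ []
allPt (suc n) u =
  concatMap (λ i → map (λ f → cons i f) (allPt n (λ a → u (suc a)))) (allFin (u zero))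
  where
  cons : Fin (u zero) → Pt n (λ a → u (suc a)) → Pt (suc n) u
  cons i f zero    = i
  cons i f (suc a) = f a

allSubsets : (n : ℕ) → List (Subset n)
allSubsets zero    = [] ∷ []
allSubsets (suc n) = concatMap (λ s → (false ∷ s) ∷ (true ∷ s) ∷ []) (allSubsets n)

R : ∀ {n u} → Subset n → Pt n u → Pt n u → Set
R g v w = ∀ a → (¬ (v a ≡ w a)) ⇔ (a ∈ g)

Rᵇ : ∀ {n u} → Subset n → Pt n u → Pt n u → Bool
Rᵇ {n} g v w = and (map check (allFin n))
  where
  check : Fin n → Bool
  check a with v a ≟F w a | lookup g a
  ... | yes _ | false = true
  ... | no  _ | true  = true
  ... | _     | _     = false

k : ∀ {n u} → Pt n u → Subset n → ℕ
k {n} {u} x g = length (filter (λ w → Data.Bool._≟_ (Rᵇ g x w) true) (allPt n u))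
  where import Data.Bool

_⊕_ : ∀ {n} → Subset n → Subset n → Subset n
g ⊕ h = (g ─ h) ∪ (h ─ g)

tilde : ∀ {n} (u : Fin n → ℕ) → Subset n → Subset n
tilde u g = tabulate (λ a → lookup g a ∧ (2 <ᵇ u a))

_⊙[_]_ : ∀ {n} → Subset n → (Fin n → ℕ) → Subset n → Subset n
g ⊙[ u ] h = (g ⊕ h) ∪ tilde u (g ∩ h)

module Matrices {c ℓ} (F : Field c ℓ) {n : ℕ} (u : Fin n → ℕ) where
  open Field F

  X : Set
  X = Pt n u

  Mat : Set c
  Mat = X → X → Carrier

  infix 4 _≋_
  _≋_ : Mat → Mat → Set ℓ
  M ≋ N = ∀ v w → M v w ≈ N v w

  sumL : List Carrier → Carrier
  sumL = foldr _+_ 0#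

  _⊞_ : Mat → Mat → Mat
  (M ⊞ N) v w = M v w + N v w

  _·_ : Carrier → Mat → Mat
  (λ' · M) v w = λ' * M v w

  _⊠_ : Mat → Mat → Mat
  (M ⊠ N) v w = sumL (map (λ z → M v z * N z w) (allPt n u))

  𝟘 : Mat
  𝟘 v w = 0#

  b2F : Bool → Carrier
  b2F true  = 1#
  b2F false = 0#

  𝟙 : Mat
  𝟙 v w = b2F (Rᵇ {n} {u} (V.replicate n false) v w)

  -_ᴹ : Mat → Mat
  (- M ᴹ) v w = - (M v w)

  prod : List Mat → Mat
  prod = foldr _⊠_ 𝟙

  ι : ℕ → Carrier
  ι zero    = 0#
  ι (suc m) = 1# + ι m

  A : Subset n → Mat
  A g v w = b2F (Rᵇ g v w)

  E* : X → Subset n → Mat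
  E* x g v w = b2F (Rᵇ {n} {u} (V.replicate n false) v w ∧ Rᵇ g x v)

  data InT (x : X) : Mat → Set (c ⊔ ℓ) where
    genA : ∀ g → InT x (A g)
    genE : ∀ g → InT x (E* x g)
    one  : InT x 𝟙
    zer  : InT x 𝟘
    add  : ∀ {M N} → InT x M → InT x N → InT x (M ⊞ N)
    scal : ∀ λ' {M} → InT x M → InT x (λ' · M)
    mul  : ∀ {M N} → InT x M → InT x N → InT x (M ⊠ N)
    resp : ∀ {M N} → InT x M → M ≋ N → InT x N

  B : X → Subset n → Subset n → Subset n → Mat
  B x g h i v w =
    sumL (map (λ j → ((E* x g ⊠ A j) ⊠ E* x i) v w)
              (filter (λ j → ((g ⊕ i) ⊆? j) ×-dec (j ⊆? h)) (allSubsets n)))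

  -- 𝕀 = F-span of { B_{a,b,c} : a ⊕ b ⊆ c ⊆ a ⊙ b, p ∣ k_b }
  data InI (x : X) : Mat → Set (c ⊔ ℓ) where
    gen  : ∀ a b c' → (a ⊕ b) ⊆ c' → c' ⊆ (a ⊙[ u ] b) → ι (k x b) ≈ 0# →
           InI x (B x a b c')
    zer  : InI x 𝟘
    add  : ∀ {M N} → InI x M → InI x N → InI x (M ⊞ N)
    scal : ∀ λ' {M} → InI x M → InI x (λ' · M)
    resp : ∀ {M N} → InI x M → M ≋ N → InI x N

  data AllIn {p} (S : Mat → Set p) : List Mat → Set (c ⊔ p) where
    []  : AllIn S []
    _∷_ : ∀ {M Ms} → S M → AllIn S Ms → AllIn S (M ∷ Ms)

  ProductsVanish : ∀ {p} → (Mat → Set p) → ℕ → Set (c ⊔ ℓ ⊔ p)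
  ProductsVanish S h = ∀ (Ms : List Mat) → length Ms ≡ h → AllIn S Ms → prod Ms ≋ 𝟘

  NilpotencyIndex : ∀ {p} → (Mat → Set p) → ℕ → Set (c ⊔ ℓ ⊔ p)
  NilpotencyIndex S h =
    1 ≤ h × ProductsVanish S h × (∀ h' → 1 ≤ h' → h' < h → ¬ ProductsVanish S h')

  -- S is a two-sided ideal of 𝕋 (S is already a subspace by construction)
  IsTwoSidedIdeal : ∀ {p} → X → (Mat → Set p) → Set (c ⊔ ℓ ⊔ p)
  IsTwoSidedIdeal x S =
    (∀ {M} → S M → InT x M) ×
    (∀ {M N} → InT x M → S N → S (M ⊠ N)) ×
    (∀ {M N} → S M → InT x N → S (M ⊠ N))

  InRad : X → Mat → Set (c ⊔ ℓ)
  InRad x M = InT x M ×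
    (∀ Y → InT x Y → ∃ λ Z → InT x Z × ((Z ⊠ (𝟙 ⊞ (- (Y ⊠ M) ᴹ))) ≋ 𝟙))

{-# OPTIONS --safe #-}
module Submission where

-- Every matrix of 𝕋 is a sum of tensor products over the coordinates a of matrices on
-- U_a, and the factors can be taken in the five-dimensional algebra of matrices on U_a
-- commuting with the stabiliser of x_a.  In coordinates (value at (x,x), on row x, on
-- column x, extra value on the diagonal off x, common value off x) its product has the
-- single structure constant κ = u_a − 1.  When p ∣ u_a − 1 we have κ = 0, and then the
-- first and fourth coordinates are characters whose common kernel J satisfies J³ = 0.
-- Giving a tensor the sum over a ∈ S of the J-degrees of its factors defines a filtration
-- of 𝕋 that is multiplicative: 𝕋 has degree ≥ 0, 𝕀 degree ≥ 1, and degree ≥ 2N + 1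
-- forces a factor in J³ = 0.  Conversely every tensor of degree ≥ 1 expands in the
-- B-basis into generators of 𝕀, so 𝕀 is an ideal, and since 1 − YM has the inverse
-- 1 + YM + … + (YM)^{2N} it lies in the radical.  Finally, for a ∈ S the generators
-- B_{S,{a},S∖{a}} and B_{S∖{a},{a},S} multiply locally to the all-ones matrix off x_a,
-- so the product of these 2N generators has a non-zero diagonal entry.

open import Level using (_⊔_)
open import Defs
open import Data.Bool.Base using (Bool; true; false; not; _∧_; _∨_; _xor_; if_then_else_)
import Data.Bool.Properties as Bool
open import Data.Bool.ListAction using (and)
open import Data.Empty using (⊥-elim)
open import Data.Fin.Base using (Fin; zero; suc; punchIn; punchOut)
open import Data.Fin.Properties using (_≟_; any?; punchIn-injective; punchInᵢ≢i; punchIn-punchOut)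
open import Data.Fin.Subset using (Subset; _∈_; _⊆_; _∩_; _─_; ⁅_⁆; ∣_∣)
open import Data.Fin.Subset.Properties using (_⊆?_; _∈?_)
open import Data.List.Base as List
  using (List; []; _∷_; map; foldr; allFin; tabulate; filter; concatMap; _++_; length)
import Data.List.Properties as List
open import Data.List.Relation.Unary.All as All using (All; []; _∷_)
import Data.List.Relation.Unary.All.Properties as All
open import Data.Nat.Base as ℕ using (ℕ; zero; suc; pred; _≤_; _<_; _<ᵇ_; z≤n; s≤s)
import Data.Nat.Properties as ℕ
open import Data.Product.Base using (∃; _×_; _,_; proj₁; proj₂)
open import Data.Unit.Polymorphic using (⊤; tt)
open import Data.Vec.Base using ([]; _∷_; lookup; replicate; here; there)
open import Data.Vec.Properties
  using (lookup-zipWith; lookup∘tabulate; lookup-replicate; []=⇒lookup; lookup⇒[]=)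
open import Function.Base using (_∘_; id)
open import Function.Bundles using (_⇔_; Equivalence)
open import Relation.Binary.PropositionalEquality as ≡ using (_≡_)
open import Relation.Nullary using (¬_; Dec; yes; no; does; contradiction)
open import Relation.Nullary.Decidable using (dec-true; dec-false; _×-dec_)

infixr 6 _⇒ᵇ_
_⇒ᵇ_ : Bool → Bool → Bool
false ⇒ᵇ _ = true
true  ⇒ᵇ b = b

∧-true : ∀ {a b} → a ∧ b ≡ true → a ≡ true × b ≡ true
∧-true {true} {true} _ = ≡.refl , ≡.refl

does-≟-refl : ∀ {n} (i : Fin n) → does (i ≟ i) ≡ true
does-≟-refl i = dec-true (i ≟ i) ≡.refl

does-≟-sym : ∀ {n} (i j : Fin n) → does (i ≟ j) ≡ does (j ≟ i)
does-≟-sym i j with i ≟ j | j ≟ i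
... | yes _   | yes _   = ≡.refl
... | no _    | no _    = ≡.refl
... | yes i≡j | no j≢i  = contradiction (≡.sym i≡j) j≢i
... | no i≢j  | yes j≡i = contradiction (≡.sym j≡i) i≢j

does-punchIn≟punchIn : ∀ {n} (x : Fin (suc n)) i j → does (punchIn x i ≟ punchIn x j) ≡ does (i ≟ j)
does-punchIn≟punchIn x i j with i ≟ j
... | yes ≡.refl = does-≟-refl (punchIn x i)
... | no i≢j     = dec-false (punchIn x i ≟ punchIn x j) (i≢j ∘ punchIn-injective x i j)

does-≟-punchIn : ∀ {n} (x : Fin (suc n)) i → does (x ≟ punchIn x i) ≡ false
does-≟-punchIn x i = dec-false (x ≟ punchIn x i) (punchInᵢ≢i x i ∘ ≡.sym)

module _ {a} {A : Set a} (h : A → Bool) where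

  and-map-true : ∀ {n} (f : Fin n → A) → and (map h (tabulate f)) ≡ true → ∀ i → h (f i) ≡ true
  and-map-true f eq zero    with h (f zero) | eq
  ... | true | _ = ≡.refl
  and-map-true f eq (suc i) with h (f zero) | eq
  ... | true | eq′ = and-map-true (f ∘ suc) eq′ i

  and-map-false : ∀ {n} (f : Fin n → A) → and (map h (tabulate f)) ≡ false → ∃ λ i → h (f i) ≡ false
  and-map-false {suc n} f eq with h (f zero) in hf0
  ... | false = zero , hf0
  ... | true  = let i , e = and-map-false (f ∘ suc) eq in suc i , e

  and-map-intro : ∀ {n} (f : Fin n → A) → (∀ i → h (f i) ≡ true) → and (map h (tabulate f)) ≡ true
  and-map-intro {zero}  f _ = ≡.refl
  and-map-intro {suc n} f H rewrite H zero = and-map-intro (f ∘ suc) (H ∘ suc)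

  and-map-refute : ∀ {n} (f : Fin n → A) i → h (f i) ≡ false → and (map h (tabulate f)) ≡ false
  and-map-refute f zero    e rewrite e = ≡.refl
  and-map-refute f (suc i) e with h (f zero)
  ... | true  = and-map-refute (f ∘ suc) i e
  ... | false = ≡.refl

-- Defs.Rᵇ tests each coordinate with a where-bound function that cannot be named here,
-- so Rᵇ is compared with its named copy only through the values true and false.
module _ {n} {u : Fin n → ℕ} (g : Subset n) (v w : Pt n u) where

  agrees : Fin n → Bool
  agrees a = does (v a ≟ w a) xor lookup g a

  private
    Rᵇ-true : Rᵇ g v w ≡ true → ∀ a → agrees a ≡ true
    Rᵇ-true eq a with and-map-true _ id eq a
    ... | e with v a ≟ w a | lookup g a
    ... | yes _ | false = ≡.refl
    ... | no _  | true  = ≡.refl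
    ... | yes _ | true  = e
    ... | no _  | false = e

    Rᵇ-false : Rᵇ g v w ≡ false → ∃ λ a → agrees a ≡ false
    Rᵇ-false eq with and-map-false _ id eq
    ... | a , e with v a ≟ w a in va≟wa | lookup g a in ga
    ... | yes _ | false = contradiction e λ ()
    ... | no _  | true  = contradiction e λ ()
    ... | yes _ | true  = a , ≡.subst₂ (λ d b → does d xor b ≡ false) (≡.sym va≟wa) (≡.sym ga) ≡.refl
    ... | no _  | false = a , ≡.subst₂ (λ d b → does d xor b ≡ false) (≡.sym va≟wa) (≡.sym ga) ≡.refl

  Rᵇ≡and-agrees : Rᵇ g v w ≡ and (map agrees (allFin n))
  Rᵇ≡and-agrees with Rᵇ g v w in eq
  ... | true  = ≡.sym (and-map-intro agrees id (Rᵇ-true eq))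
  ... | false = let a , e = Rᵇ-false eq in ≡.sym (and-map-refute agrees id a e)

lookup-─ : ∀ {n} (p q : Subset n) i → lookup (p ─ q) i ≡ lookup p i ∧ not (lookup q i)
lookup-─ (a ∷ p)     (b ∷ q)     (suc i) = lookup-─ p q i
lookup-─ (true  ∷ p) (true  ∷ q) zero    = ≡.refl
lookup-─ (true  ∷ p) (false ∷ q) zero    = ≡.refl
lookup-─ (false ∷ p) (true  ∷ q) zero    = ≡.refl
lookup-─ (false ∷ p) (false ∷ q) zero    = ≡.refl

lookup-⊕ : ∀ {n} (p q : Subset n) i → lookup (p ⊕ q) i ≡ lookup p i xor lookup q i
lookup-⊕ p q i
  rewrite lookup-zipWith _∨_ i (p ─ q) (q ─ p) | lookup-─ p q i | lookup-─ q p i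
  with lookup p i | lookup q i
... | true  | true  = ≡.refl
... | true  | false = ≡.refl
... | false | true  = ≡.refl
... | false | false = ≡.refl

lookup-⊙ : ∀ {n} (u : Fin n → ℕ) (p q : Subset n) i →
           lookup (p ⊙[ u ] q) i ≡ (lookup p i xor lookup q i) ∨ ((lookup p i ∧ lookup q i) ∧ (2 <ᵇ u i))
lookup-⊙ u p q i
  rewrite lookup-zipWith _∨_ i (p ⊕ q) (tilde u (p ∩ q)) | lookup-⊕ p q i
        | lookup∘tabulate (λ a → lookup (p ∩ q) a ∧ (2 <ᵇ u a)) i
        | lookup-zipWith _∧_ i p q = ≡.refl

lookup-⁅⁆ : ∀ {n} (t i : Fin n) → lookup ⁅ t ⁆ i ≡ does (i ≟ t)
lookup-⁅⁆ zero    zero    = ≡.refl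
lookup-⁅⁆ zero    (suc i) = lookup-replicate i false
lookup-⁅⁆ (suc t) zero    = ≡.refl
lookup-⁅⁆ (suc t) (suc i) = lookup-⁅⁆ t i

⊆-from-lookup : ∀ {n} {p q : Subset n} → (∀ i → (lookup p i ⇒ᵇ lookup q i) ≡ true) → p ⊆ q
⊆-from-lookup {p = p} {q} H {i} i∈p =
  lookup⇒[]= i q (≡.subst (λ b → (b ⇒ᵇ lookup q i) ≡ true) ([]=⇒lookup i∈p) (H i))

does-⊆? : ∀ {n} (p q : Subset n) → does (p ⊆? q) ≡ and (map (λ i → lookup p i ⇒ᵇ lookup q i) (allFin n))
does-⊆? {n} p q = ≡.trans (does-⊆?-tabulate p q) (≡.cong and (≡.sym (List.map-tabulate {n = n} id _)))
  where
  does-⊆?-tabulate : ∀ {n} (p q : Subset n) → does (p ⊆? q) ≡ and (tabulate (λ i → lookup p i ⇒ᵇ lookup q i))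
  does-⊆?-tabulate []          []          = ≡.refl
  does-⊆?-tabulate (false ∷ p) (_ ∷ q)     = does-⊆?-tabulate p q
  does-⊆?-tabulate (true ∷ p)  (false ∷ q) = ≡.refl
  does-⊆?-tabulate (true ∷ p)  (true ∷ q)  = does-⊆?-tabulate p q

admissible : Bool → Bool → Bool → Bool → Bool
admissible a b c big = ((a xor b) ⇒ᵇ c) ∧ (c ⇒ᵇ ((a xor b) ∨ ((a ∧ b) ∧ big)))

admissible⇒⊆ : ∀ {n} (u : Fin n → ℕ) (a b c : Subset n) →
               (∀ t → admissible (lookup a t) (lookup b t) (lookup c t) (2 <ᵇ u t) ≡ true) →
               (a ⊕ b) ⊆ c × c ⊆ (a ⊙[ u ] b)
admissible⇒⊆ u a b c adm =
  ⊆-from-lookup (λ t → ≡.subst (λ z → (z ⇒ᵇ lookup c t) ≡ true) (≡.sym (lookup-⊕ a b t))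
                               (proj₁ (∧-true (adm t)))) ,
  ⊆-from-lookup (λ t → ≡.subst (λ z → (lookup c t ⇒ᵇ z) ≡ true) (≡.sym (lookup-⊙ u a b t))
                               (proj₂ (∧-true (adm t))))

sumOver : ∀ {n} → Subset n → (Fin n → ℕ) → ℕ
sumOver []          f = 0
sumOver (true ∷ S)  f = f zero ℕ.+ sumOver S (f ∘ suc)
sumOver (false ∷ S) f = sumOver S (f ∘ suc)

sumOver-+ : ∀ {n} (S : Subset n) f g → sumOver S (λ t → f t ℕ.+ g t) ≡ sumOver S f ℕ.+ sumOver S g
sumOver-+ []          f g = ≡.refl
sumOver-+ (false ∷ S) f g = sumOver-+ S (f ∘ suc) (g ∘ suc)
sumOver-+ (true ∷ S)  f g rewrite sumOver-+ S (f ∘ suc) (g ∘ suc) = interchange (f zero) (g zero) _ _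
  where open import Algebra.Properties.CommutativeSemigroup ℕ.+-commutativeSemigroup using (interchange)

sumOver-≥ : ∀ {n} (S : Subset n) f {t} → t ∈ S → f t ≤ sumOver S f
sumOver-≥ (true ∷ S)  f here        = ℕ.m≤m+n (f zero) _
sumOver-≥ (true ∷ S)  f (there t∈S) = ℕ.≤-trans (sumOver-≥ S (f ∘ suc) t∈S) (ℕ.m≤n+m _ (f zero))
sumOver-≥ (false ∷ S) f (there t∈S) = sumOver-≥ S (f ∘ suc) t∈S

pigeonhole : ∀ {n} k (S : Subset n) f → k ℕ.* ∣ S ∣ < sumOver S f → ∃ λ t → t ∈ S × k < f t
pigeonhole k []          f ()
pigeonhole k (false ∷ S) f lt = let t , t∈S , k<ft = pigeonhole k S (f ∘ suc) lt in suc t , there t∈S , k<ft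
pigeonhole k (true ∷ S)  f lt with k ℕ.<? f zero
... | yes k<f0 = zero , here , k<f0
... | no k≮f0  = let t , t∈S , k<ft = pigeonhole k S (f ∘ suc) rest in suc t , there t∈S , k<ft
  where
  rest : k ℕ.* ∣ S ∣ < sumOver S (f ∘ suc)
  rest = ℕ.+-cancelˡ-< k _ _
           (ℕ.<-≤-trans (≡.subst (_< f zero ℕ.+ sumOver S (f ∘ suc)) (ℕ.*-suc k ∣ S ∣) lt)
                        (ℕ.+-monoˡ-≤ (sumOver S (f ∘ suc)) (ℕ.≮⇒≥ k≮f0)))

elements : ∀ {n} → Subset n → List (Fin n)
elements []          = []
elements (true ∷ S)  = zero ∷ map suc (elements S)
elements (false ∷ S) = map suc (elements S)

length-elements : ∀ {n} (S : Subset n) → length (elements S) ≡ ∣ S ∣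
length-elements []          = ≡.refl
length-elements (true ∷ S)  = ≡.cong suc (≡.trans (List.length-map suc (elements S)) (length-elements S))
length-elements (false ∷ S) = ≡.trans (List.length-map suc (elements S)) (length-elements S)

elements⊆ : ∀ {n} (S : Subset n) → All (_∈ S) (elements S)
elements⊆ []          = []
elements⊆ (true ∷ S)  = here ∷ All.map⁺ (All.map there (elements⊆ S))
elements⊆ (false ∷ S) = All.map⁺ (All.map there (elements⊆ S))

occurrences : ∀ {n} → Fin n → List (Fin n) → ℕ
occurrences t []       = 0
occurrences t (s ∷ xs) = (if does (t ≟ s) then suc else id) (occurrences t xs)

occurrences-zero-map-suc : ∀ {n} (xs : List (Fin n)) → occurrences zero (map suc xs) ≡ 0
occurrences-zero-map-suc []       = ≡.refl
occurrences-zero-map-suc (_ ∷ xs) = occurrences-zero-map-suc xs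

occurrences-suc-map-suc : ∀ {n} (t : Fin n) xs → occurrences (suc t) (map suc xs) ≡ occurrences t xs
occurrences-suc-map-suc t []       = ≡.refl
occurrences-suc-map-suc t (s ∷ xs) with does (t ≟ s)
... | true  = ≡.cong suc (occurrences-suc-map-suc t xs)
... | false = occurrences-suc-map-suc t xs

occurrences-elements : ∀ {n} (S : Subset n) {t} → t ∈ S → occurrences t (elements S) ≡ 1
occurrences-elements (true ∷ S)  here        = ≡.cong suc (occurrences-zero-map-suc (elements S))
occurrences-elements (true ∷ S)  (there t∈S) =
  ≡.trans (occurrences-suc-map-suc _ (elements S)) (occurrences-elements S t∈S)
occurrences-elements (false ∷ S) (there t∈S) =
  ≡.trans (occurrences-suc-map-suc _ (elements S)) (occurrences-elements S t∈S)

module BigOperators {c ℓ} (F : Field c ℓ) where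

  open Field F hiding (zero)
  open import Relation.Binary.Reasoning.Setoid setoid
  open import Algebra.Properties.Ring ring using (-1*x≈-x; +-cancelˡ)
  open import Algebra.Properties.CommutativeSemigroup +-commutativeSemigroup
    using () renaming (interchange to +-interchange)
  open import Algebra.Properties.CommutativeSemigroup *-commutativeSemigroup using (xy∙z≈y∙xz)
  open import Algebra.Properties.Semiring.Sum semiring public
    using (sum; sum-cong-≋; sum-cong-≗; ∑-distrib-+; *-distribˡ-sum; sum-remove; sum-replicate-zero)
  open import Algebra.Properties.CommutativeMonoid.Sum *-commutativeMonoid public
    using () renaming (sum to ∏; sum-cong-≋ to ∏-cong; ∑-distrib-+ to ∏-distrib-*; sum-replicate-zero to ∏-1)

  ι : ℕ → Carrier
  ι zero    = 0#
  ι (suc m) = 1# + ι m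

  ι≡ : ∀ {n} {u : Fin n → ℕ} m → Matrices.ι F u m ≡ ι m
  ι≡ zero    = ≡.refl
  ι≡ (suc m) = ≡.cong (1# +_) (ι≡ m)

  ι-suc≈1⇒ι≈0 : ∀ m → ι (suc m) ≈ 1# → ι m ≈ 0#
  ι-suc≈1⇒ι≈0 m eq = +-cancelˡ 1# (ι m) 0# (trans eq (sym (+-identityʳ 1#)))

  b2F : Bool → Carrier
  b2F true  = 1#
  b2F false = 0#

  b2F≡ : ∀ {n} {u : Fin n → ℕ} b → Matrices.b2F F u b ≡ b2F b
  b2F≡ true  = ≡.refl
  b2F≡ false = ≡.refl

  b2F-∧ : ∀ a b → b2F (a ∧ b) ≈ b2F a * b2F b
  b2F-∧ true  b = sym (*-identityˡ _)
  b2F-∧ false b = sym (zeroˡ _)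

  b2F-and : ∀ {a n} {A : Set a} (h : A → Bool) (f : Fin n → A) →
            b2F (and (map h (tabulate f))) ≈ ∏ (b2F ∘ h ∘ f)
  b2F-and {n = zero}  h f = refl
  b2F-and {n = suc n} h f = trans (b2F-∧ (h (f zero)) _) (*-congˡ (b2F-and h (f ∘ suc)))

  δ : ∀ {m} → Fin m → Fin m → Carrier
  δ i j = b2F (does (i ≟ j))

  ∑ : ∀ {a} {A : Set a} → List A → (A → Carrier) → Carrier
  ∑ xs f = foldr _+_ 0# (map f xs)

  module _ {a} {A : Set a} where

    ∑-cong : ∀ (xs : List A) {f g : A → Carrier} → (∀ z → f z ≈ g z) → ∑ xs f ≈ ∑ xs g
    ∑-cong []       f≈g = refl
    ∑-cong (z ∷ xs) f≈g = +-cong (f≈g z) (∑-cong xs f≈g)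

    ∑-zero : ∀ (xs : List A) {f : A → Carrier} → (∀ z → f z ≈ 0#) → ∑ xs f ≈ 0#
    ∑-zero []       f≈0 = refl
    ∑-zero (z ∷ xs) f≈0 = trans (+-cong (f≈0 z) (∑-zero xs f≈0)) (+-identityˡ 0#)

    ∑-+ : ∀ (xs : List A) f g → ∑ xs (λ z → f z + g z) ≈ ∑ xs f + ∑ xs g
    ∑-+ []       f g = sym (+-identityˡ 0#)
    ∑-+ (z ∷ xs) f g = trans (+-congˡ (∑-+ xs f g)) (+-interchange _ _ _ _)

    ∑-*ˡ : ∀ (xs : List A) a f → ∑ xs (λ z → a * f z) ≈ a * ∑ xs f
    ∑-*ˡ []       a f = sym (zeroʳ a)
    ∑-*ˡ (z ∷ xs) a f = trans (+-congˡ (∑-*ˡ xs a f)) (sym (distribˡ a _ _))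

    ∑-*ʳ : ∀ (xs : List A) a f → ∑ xs (λ z → f z * a) ≈ ∑ xs f * a
    ∑-*ʳ []       a f = sym (zeroˡ a)
    ∑-*ʳ (z ∷ xs) a f = trans (+-congˡ (∑-*ʳ xs a f)) (sym (distribʳ a _ _))

    ∑-neg : ∀ (xs : List A) f → ∑ xs (λ z → - f z) ≈ - ∑ xs f
    ∑-neg xs f = begin
      ∑ xs (λ z → - f z)      ≈⟨ ∑-cong xs (λ z → sym (-1*x≈-x (f z))) ⟩
      ∑ xs (λ z → - 1# * f z) ≈⟨ ∑-*ˡ xs (- 1#) f ⟩
      - 1# * ∑ xs f           ≈⟨ -1*x≈-x _ ⟩
      - ∑ xs f                ∎

    ∑-++ : ∀ (xs ys : List A) f → ∑ (xs ++ ys) f ≈ ∑ xs f + ∑ ys f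
    ∑-++ []       ys f = sym (+-identityˡ _)
    ∑-++ (z ∷ xs) ys f = trans (+-congˡ (∑-++ xs ys f)) (sym (+-assoc _ _ _))

    ∑-filter : ∀ {p} {P : A → Set p} (P? : ∀ z → Dec (P z)) xs f →
               ∑ (filter P? xs) f ≈ ∑ xs (λ z → b2F (does (P? z)) * f z)
    ∑-filter P? []       f = refl
    ∑-filter P? (z ∷ xs) f with does (P? z)
    ... | true  = +-cong (sym (*-identityˡ _)) (∑-filter P? xs f)
    ... | false = trans (∑-filter P? xs f) (sym (trans (+-congʳ (zeroˡ _)) (+-identityˡ _)))

    ι-length-filter : ∀ {p} {P : A → Set p} (P? : ∀ z → Dec (P z)) xs →
                      ι (length (filter P? xs)) ≈ ∑ xs (λ z → b2F (does (P? z)))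
    ι-length-filter P? []       = refl
    ι-length-filter P? (z ∷ xs) with does (P? z)
    ... | true  = +-congˡ (ι-length-filter P? xs)
    ... | false = trans (ι-length-filter P? xs) (sym (+-identityˡ _))

  module _ {a b} {A : Set a} {B : Set b} where

    ∑-map : ∀ (g : A → B) xs f → ∑ (map g xs) f ≡ ∑ xs (f ∘ g)
    ∑-map g xs f = ≡.cong (foldr _+_ 0#) (≡.sym (List.map-∘ xs))

    ∑-concatMap : ∀ (g : A → List B) xs f → ∑ (concatMap g xs) f ≈ ∑ xs (λ z → ∑ (g z) f)
    ∑-concatMap g []       f = refl
    ∑-concatMap g (z ∷ xs) f = trans (∑-++ (g z) (concatMap g xs) f) (+-congˡ (∑-concatMap g xs f))

    ∑-swap : ∀ (xs : List A) (ys : List B) (f : A → B → Carrier) →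
             ∑ xs (λ z → ∑ ys (f z)) ≈ ∑ ys (λ y → ∑ xs (λ z → f z y))
    ∑-swap []       ys f = sym (∑-zero ys (λ _ → refl))
    ∑-swap (z ∷ xs) ys f = trans (+-congˡ (∑-swap xs ys f)) (sym (∑-+ ys (f z) _))

  ∑-allFin : ∀ m (f : Fin m → Carrier) → ∑ (allFin m) f ≡ sum f
  ∑-allFin m f = ≡.trans (≡.cong (foldr _+_ 0#) (List.map-tabulate id f)) (foldr-tabulate m f)
    where
    foldr-tabulate : ∀ m (f : Fin m → Carrier) → foldr _+_ 0# (tabulate f) ≡ sum f
    foldr-tabulate zero    f = ≡.refl
    foldr-tabulate (suc m) f = ≡.cong (f zero +_) (foldr-tabulate m (f ∘ suc))

  ∑-allPt : ∀ n (u : Fin n → ℕ) (h : (t : Fin n) → Fin (u t) → Carrier) →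
            ∑ (allPt n u) (λ z → ∏ (λ t → h t (z t))) ≈ ∏ (λ t → sum (h t))
  ∑-allPt zero    u h = +-identityʳ 1#
  ∑-allPt (suc n) u h = begin
    ∑ (allPt (suc n) u) (λ z → ∏ (λ t → h t (z t)))
      ≈⟨ ∑-concatMap _ (allFin (u zero)) _ ⟩
    ∑ (allFin (u zero)) (λ i → ∑ (map _ (allPt n (u ∘ suc))) (λ z → ∏ (λ t → h t (z t))))
      ≈⟨ ∑-cong (allFin (u zero)) (λ i → reflexive (∑-map _ (allPt n (u ∘ suc)) _)) ⟩
    ∑ (allFin (u zero)) (λ i → ∑ (allPt n (u ∘ suc)) (λ z → h zero i * ∏ (λ t → h (suc t) (z t))))
      ≈⟨ ∑-cong (allFin (u zero)) (λ i → ∑-*ˡ (allPt n (u ∘ suc)) (h zero i) _) ⟩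
    ∑ (allFin (u zero)) (λ i → h zero i * ∑ (allPt n (u ∘ suc)) (λ z → ∏ (λ t → h (suc t) (z t))))
      ≈⟨ ∑-*ʳ (allFin (u zero)) _ (h zero) ⟩
    ∑ (allFin (u zero)) (h zero) * ∑ (allPt n (u ∘ suc)) (λ z → ∏ (λ t → h (suc t) (z t)))
      ≈⟨ *-cong (reflexive (∑-allFin (u zero) (h zero))) (∑-allPt n (u ∘ suc) (h ∘ suc)) ⟩
    ∏ (λ t → sum (h t)) ∎

  Σᵇ : (Bool → Carrier) → Carrier
  Σᵇ h = h false + h true

  Σ³ : (Bool → Bool → Bool → Carrier) → Carrier
  Σ³ h = Σᵇ λ a → Σᵇ λ b → Σᵇ λ c → h a b c

  Σ³-cong : ∀ {f g : Bool → Bool → Bool → Carrier} → (∀ a b c → f a b c ≈ g a b c) → Σ³ f ≈ Σ³ g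
  Σ³-cong f≈g = +-cong (+-cong (+-cong (f≈g _ _ _) (f≈g _ _ _)) (+-cong (f≈g _ _ _) (f≈g _ _ _)))
                       (+-cong (+-cong (f≈g _ _ _) (f≈g _ _ _)) (+-cong (f≈g _ _ _) (f≈g _ _ _)))

  ∑-allSubsets : ∀ n (h : Fin n → Bool → Carrier) →
                 ∑ (allSubsets n) (λ j → ∏ (λ t → h t (lookup j t))) ≈ ∏ (λ t → Σᵇ (h t))
  ∑-allSubsets zero    h = +-identityʳ 1#
  ∑-allSubsets (suc n) h = begin
    ∑ (allSubsets (suc n)) (λ j → ∏ (λ t → h t (lookup j t)))
      ≈⟨ ∑-concatMap _ (allSubsets n) _ ⟩
    ∑ (allSubsets n) (λ s → h zero false * G s + (h zero true * G s + 0#))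
      ≈⟨ ∑-cong (allSubsets n) (λ s → trans (+-congˡ (+-identityʳ _)) (sym (distribʳ _ _ _))) ⟩
    ∑ (allSubsets n) (λ s → Σᵇ (h zero) * G s)
      ≈⟨ ∑-*ˡ (allSubsets n) _ G ⟩
    Σᵇ (h zero) * ∑ (allSubsets n) G
      ≈⟨ *-congˡ (∑-allSubsets n (h ∘ suc)) ⟩
    ∏ (λ t → Σᵇ (h t)) ∎
    where
    G : Subset n → Carrier
    G s = ∏ (λ t → h (suc t) (lookup s t))

  ∏-Σ³ : ∀ n (h : Fin n → Bool → Bool → Bool → Carrier) →
         ∏ (λ t → Σ³ (h t)) ≈
         ∑ (allSubsets n) λ a → ∑ (allSubsets n) λ b → ∑ (allSubsets n) λ c →
           ∏ (λ t → h t (lookup a t) (lookup b t) (lookup c t))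
  ∏-Σ³ n h = begin
    ∏ (λ t → Σ³ (h t))
      ≈⟨ ∑-allSubsets n (λ t a → Σᵇ λ b → Σᵇ λ c → h t a b c) ⟨
    ∑ subsets (λ a → ∏ (λ t → Σᵇ λ b → Σᵇ λ c → h t (lookup a t) b c))
      ≈⟨ ∑-cong subsets (λ a → sym (∑-allSubsets n (λ t b → Σᵇ λ c → h t (lookup a t) b c))) ⟩
    ∑ subsets (λ a → ∑ subsets λ b → ∏ (λ t → Σᵇ λ c → h t (lookup a t) (lookup b t) c))
      ≈⟨ ∑-cong subsets (λ a → ∑-cong subsets (λ b →
           sym (∑-allSubsets n (λ t c → h t (lookup a t) (lookup b t) c)))) ⟩
    ∑ subsets (λ a → ∑ subsets λ b → ∑ subsets λ c → ∏ (λ t → h t (lookup a t) (lookup b t) (lookup c t))) ∎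
    where subsets = allSubsets n

  sum-δ : ∀ {m} (i : Fin m) (f : Fin m → Carrier) → sum (λ k → δ i k * f k) ≈ f i
  sum-δ {suc m} zero    f =
    trans (+-cong (*-identityˡ (f zero)) (trans (sum-cong-≋ {m} (λ k → zeroˡ (f (suc k)))) (sum-replicate-zero m)))
          (+-identityʳ _)
  sum-δ {suc m} (suc i) f = trans (+-cong (zeroˡ _) (sum-δ i (f ∘ suc))) (+-identityˡ _)

  sum-δʳ : ∀ {m} (f : Fin m → Carrier) j → sum (λ k → f k * δ k j) ≈ f j
  sum-δʳ f j = trans (sum-cong-≋ swap) (sum-δ j f)
    where
    swap : ∀ k → f k * δ k j ≈ δ j k * f k
    swap k = trans (*-comm (f k) _) (reflexive (≡.cong (λ d → b2F d * f k) (does-≟-sym k j)))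

  sum-const : ∀ m (a : Carrier) → sum {m} (λ _ → a) ≈ ι m * a
  sum-const zero    a = sym (zeroˡ a)
  sum-const (suc m) a = trans (+-cong (sym (*-identityˡ a)) (sum-const m a)) (sym (distribʳ a 1# (ι m)))

  module _ {m : ℕ} where

    sum-affine : ∀ α β (i : Fin m) f → sum (λ k → (α * δ i k + β) * f k) ≈ α * f i + β * sum f
    sum-affine α β i f = begin
      sum (λ k → (α * δ i k + β) * f k)
        ≈⟨ sum-cong-≋ {m} (λ k → distribʳ (f k) _ _) ⟩
      sum (λ k → α * δ i k * f k + β * f k)
        ≈⟨ ∑-distrib-+ {m} (λ k → α * δ i k * f k) (λ k → β * f k) ⟩
      sum (λ k → α * δ i k * f k) + sum (λ k → β * f k)
        ≈⟨ +-cong (sum-cong-≋ {m} (λ k → xy∙z≈y∙xz α _ (f k))) (sym (*-distribˡ-sum β f)) ⟩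
      sum (λ k → δ i k * (α * f k)) + β * sum f
        ≈⟨ +-congʳ (sum-δ i (λ k → α * f k)) ⟩
      α * f i + β * sum f ∎

    sum-column : ∀ γ ε (j : Fin m) → sum (λ k → γ * δ k j + ε) ≈ γ + ι m * ε
    sum-column γ ε j = begin
      sum (λ k → γ * δ k j + ε)                  ≈⟨ ∑-distrib-+ {m} (λ k → γ * δ k j) (λ _ → ε) ⟩
      sum (λ k → γ * δ k j) + sum {m} (λ _ → ε)  ≈⟨ +-cong (sum-δʳ (λ _ → γ) j) (sum-const m ε) ⟩
      γ + ι m * ε                                ∎

  ∏-zero : ∀ {n} (f : Fin n → Carrier) t → f t ≈ 0# → ∏ f ≈ 0#
  ∏-zero f zero    ft≈0 = trans (*-congʳ ft≈0) (zeroˡ _)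
  ∏-zero f (suc t) ft≈0 = trans (*-congˡ (∏-zero (f ∘ suc) t ft≈0)) (zeroʳ _)

  ∏-one : ∀ {n} (f : Fin n → Carrier) → (∀ t → f t ≈ 1#) → ∏ f ≈ 1#
  ∏-one {n} f f≈1 = trans (∏-cong f≈1) (∏-1 n)

  *-nonzero : ∀ {x y} → ¬ x ≈ 0# → ¬ y ≈ 0# → ¬ x * y ≈ 0#
  *-nonzero {x} {y} x≉0 y≉0 xy≈0 with inverse x x≉0
  ... | x⁻¹ , xx⁻¹≈1 = y≉0 (begin
    y               ≈⟨ *-identityˡ y ⟨
    1# * y          ≈⟨ *-congʳ (trans (*-comm x⁻¹ x) xx⁻¹≈1) ⟨
    (x⁻¹ * x) * y   ≈⟨ *-assoc x⁻¹ x y ⟩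
    x⁻¹ * (x * y)   ≈⟨ *-congˡ xy≈0 ⟩
    x⁻¹ * 0#        ≈⟨ zeroʳ x⁻¹ ⟩
    0#              ∎)

  ∏-nonzero : ∀ {n} (f : Fin n → Carrier) → (∀ t → ¬ f t ≈ 0#) → ¬ ∏ f ≈ 0#
  ∏-nonzero {zero}  f _   = 1≉0
  ∏-nonzero {suc n} f f≉0 = *-nonzero (f≉0 zero) (∏-nonzero (f ∘ suc) (f≉0 ∘ suc))

module OrbitAlgebra {c ℓ} (F : Field c ℓ) where

  open Field F hiding (zero)
  open BigOperators F
  open import Relation.Binary.Reasoning.Setoid setoid
  open import Algebra.Solver.Ring.NaturalCoefficients.Default commutativeSemiring

  record Orb : Set c where
    constructor orb
    field
      xx xy yx diag ones : Carrier
  open Orb public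

  LMat : ℕ → Set c
  LMat m = Fin m → Fin m → Carrier

  infixl 7 _⊡_
  _⊡_ : ∀ {m} → LMat m → LMat m → LMat m
  (f ⊡ g) p q = sum (λ k → f p k * g k q)

  entry : Orb → ∀ {m} → Fin m → LMat m
  entry φ x p q with x ≟ p | x ≟ q
  ... | yes _ | yes _ = xx φ
  ... | yes _ | no _  = xy φ
  ... | no _  | yes _ = yx φ
  ... | no _  | no _  = diag φ * δ p q + ones φ

  data Position {m} (x : Fin (suc m)) : Fin (suc m) → Set where
    at   : Position x x
    away : ∀ i → Position x (punchIn x i)

  position : ∀ {m} (x p : Fin (suc m)) → Position x p
  position x p with x ≟ p
  ... | yes ≡.refl = at
  ... | no x≢p  = ≡.subst (Position x) (punchIn-punchOut x≢p) (away (punchOut x≢p))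

  entryᵖ : Orb → ∀ {m} {x p q : Fin (suc m)} → Position x p → Position x q → Carrier
  entryᵖ φ at       at       = xx φ
  entryᵖ φ at       (away _) = xy φ
  entryᵖ φ (away _) at       = yx φ
  entryᵖ φ (away i) (away j) = diag φ * δ i j + ones φ

  entry-position : ∀ φ {m} {x p q : Fin (suc m)} (P : Position x p) (Q : Position x q) →
                   entry φ x p q ≡ entryᵖ φ P Q
  entry-position φ {x = x} at at with x ≟ x
  ... | yes _  = ≡.refl
  ... | no x≢x = contradiction ≡.refl x≢x
  entry-position φ {x = x} at (away j) with x ≟ x | x ≟ punchIn x j
  ... | yes _  | no _  = ≡.refl
  ... | no x≢x | _     = contradiction ≡.refl x≢x
  ... | yes _  | yes e = contradiction (≡.sym e) (punchInᵢ≢i x j)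
  entry-position φ {x = x} (away i) at with x ≟ punchIn x i | x ≟ x
  ... | no _  | yes _  = ≡.refl
  ... | yes e | _      = contradiction (≡.sym e) (punchInᵢ≢i x i)
  ... | no _  | no x≢x = contradiction ≡.refl x≢x
  entry-position φ {x = x} (away i) (away j) with x ≟ punchIn x i | x ≟ punchIn x j
  ... | no _  | no _  = ≡.cong (λ d → diag φ * b2F d + ones φ) (does-punchIn≟punchIn x i j)
  ... | yes e | _     = contradiction (≡.sym e) (punchInᵢ≢i x i)
  ... | no _  | yes e = contradiction (≡.sym e) (punchInᵢ≢i x j)

  side : Bool → ∀ {m} {x p : Fin (suc m)} → Position x p → Bool
  side a at       = not a
  side a (away _) = a

  side-position : ∀ a {m} {x p : Fin (suc m)} (P : Position x p) → does (x ≟ p) xor a ≡ side a P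
  side-position a {x = x} at       = ≡.cong (_xor a) (does-≟-refl x)
  side-position a {x = x} (away i) = ≡.cong (_xor a) (does-≟-punchIn x i)

  entry-at : ∀ φ {m} (x : Fin m) → entry φ x x x ≡ xx φ
  entry-at φ {suc m} x = entry-position φ {x = x} at at

  away-point : ∀ {m} → 2 ≤ m → Fin m → Fin m
  away-point {suc (suc m)} _         x = punchIn x zero
  away-point {suc zero}    (s≤s ()) _

  entry-away-point : ∀ φ {m} (2≤m : 2 ≤ m) (x : Fin m) →
                     entry φ x (away-point 2≤m x) (away-point 2≤m x) ≈ diag φ + ones φ
  entry-away-point φ {suc (suc m)} _ x =
    trans (reflexive (entry-position φ {x = x} (away zero) (away zero))) (+-congʳ (*-identityʳ _))
  entry-away-point φ {suc zero} (s≤s ()) _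

  infixl 7 _⋆[_]_
  _⋆[_]_ : Orb → Carrier → Orb → Orb
  φ ⋆[ κ ] ψ = orb
    (xx φ * xx ψ + κ * (xy φ * yx ψ))
    (xx φ * xy ψ + xy φ * diag ψ + κ * (xy φ * ones ψ))
    (yx φ * xx ψ + diag φ * yx ψ + κ * (ones φ * yx ψ))
    (diag φ * diag ψ)
    (yx φ * xy ψ + diag φ * ones ψ + ones φ * diag ψ + κ * (ones φ * ones ψ))

  others : ℕ → Carrier
  others m = ι (pred m)

  ⊡-position : ∀ φ ψ {m} {x p q : Fin (suc m)} (P : Position x p) (Q : Position x q) →
               (entry φ x ⊡ entry ψ x) p q ≈
               entryᵖ φ P at * entryᵖ ψ at Q + sum (λ k → entryᵖ φ P (away k) * entryᵖ ψ (away k) Q)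
  ⊡-position φ ψ {x = x} {p} {q} P Q = trans (sum-remove {i = x} (λ k → entry φ x p k * entry ψ x k q))
    (reflexive (≡.cong₂ _+_ (≡.cong₂ _*_ (entry-position φ P at) (entry-position ψ at Q))
                            (sum-cong-≗ λ k → ≡.cong₂ _*_ (entry-position φ P (away k))
                                                            (entry-position ψ (away k) Q))))

  entry-⋆ᵖ : ∀ φ ψ {m} {x p q : Fin (suc m)} (P : Position x p) (Q : Position x q) →
             (entry φ x ⊡ entry ψ x) p q ≈ entryᵖ (φ ⋆[ ι m ] ψ) P Q
  entry-⋆ᵖ φ ψ {m} {x} at at = trans (⊡-position φ ψ {x = x} at at) (+-congˡ (sum-const m _))
  entry-⋆ᵖ φ ψ {m} {x} at (away j) = trans (⊡-position φ ψ {x = x} at (away j)) (begin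
    xx φ * xy ψ + sum (λ k → xy φ * (diag ψ * δ k j + ones ψ))
      ≈⟨ +-congˡ (trans (sym (*-distribˡ-sum {m} (xy φ) (λ k → diag ψ * δ k j + ones ψ)))
                        (*-congˡ (sum-column (diag ψ) (ones ψ) j))) ⟩
    xx φ * xy ψ + xy φ * (diag ψ + κ * ones ψ)
      ≈⟨ solve 6 (λ a b c d e k → a :* b :+ c :* (d :+ k :* e) := a :* b :+ c :* d :+ k :* (c :* e))
               refl (xx φ) (xy ψ) (xy φ) (diag ψ) (ones ψ) κ ⟩
    xy (φ ⋆[ κ ] ψ) ∎)
    where κ = ι m
  entry-⋆ᵖ φ ψ {m} {x} (away i) at = trans (⊡-position φ ψ {x = x} (away i) at) (begin
    yx φ * xx ψ + sum (λ k → (diag φ * δ i k + ones φ) * yx ψ)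
      ≈⟨ +-congˡ (trans (sum-affine (diag φ) (ones φ) i (λ _ → yx ψ))
                        (+-congˡ (*-congˡ (sum-const m (yx ψ))))) ⟩
    yx φ * xx ψ + (diag φ * yx ψ + ones φ * (κ * yx ψ))
      ≈⟨ solve 6 (λ a b c d e k → a :* b :+ (c :* d :+ e :* (k :* d)) := a :* b :+ c :* d :+ k :* (e :* d))
               refl (yx φ) (xx ψ) (diag φ) (yx ψ) (ones φ) κ ⟩
    yx (φ ⋆[ κ ] ψ) ∎)
    where κ = ι m
  entry-⋆ᵖ φ ψ {m} {x} (away i) (away j) = trans (⊡-position φ ψ {x = x} (away i) (away j)) (begin
    yx φ * xy ψ + sum (λ k → (diag φ * δ i k + ones φ) * (diag ψ * δ k j + ones ψ))
      ≈⟨ +-congˡ (trans (sum-affine (diag φ) (ones φ) i _)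
                        (+-congˡ (*-congˡ (sum-column (diag ψ) (ones ψ) j)))) ⟩
    yx φ * xy ψ + (diag φ * (diag ψ * δ i j + ones ψ) + ones φ * (diag ψ + κ * ones ψ))
      ≈⟨ solve 8 (λ a b c d e f g k → a :* b :+ (c :* (d :* g :+ e) :+ f :* (d :+ k :* e))
                   := c :* d :* g :+ (a :* b :+ c :* e :+ f :* d :+ k :* (f :* e)))
               refl (yx φ) (xy ψ) (diag φ) (diag ψ) (ones ψ) (ones φ) (δ i j) κ ⟩
    entryᵖ (φ ⋆[ κ ] ψ) {x = x} (away i) (away j) ∎)
    where κ = ι m

  entry-⋆ : ∀ φ ψ {m} (x p q : Fin m) → (entry φ x ⊡ entry ψ x) p q ≈ entry (φ ⋆[ others m ] ψ) x p q
  entry-⋆ φ ψ {suc m} x p q = trans (entry-⋆ᵖ φ ψ (position x p) (position x q))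
                                    (reflexive (≡.sym (entry-position (φ ⋆[ ι m ] ψ) (position x p) (position x q))))

  Aₗ : ∀ {m} → Bool → LMat m
  Aₗ b p q = b2F (does (p ≟ q) xor b)

  Eₗ : ∀ {m} → Fin m → Bool → LMat m
  Eₗ x a p q = Aₗ false p q * b2F (does (x ≟ p) xor a)

  Aₗ-false : ∀ {m} (p q : Fin m) → Aₗ false p q ≡ δ p q
  Aₗ-false p q = ≡.cong b2F (Bool.xor-comm (does (p ≟ q)) false)

  Aₗ-false-⊡ : ∀ {m} (f : LMat m) p q → (Aₗ false ⊡ f) p q ≈ f p q
  Aₗ-false-⊡ f p q = trans (sum-cong-≋ (λ k → *-congʳ (reflexive (Aₗ-false p k)))) (sum-δ p (λ k → f k q))

  ⊡-Aₗ-false : ∀ {m} (f : LMat m) p q → (f ⊡ Aₗ false) p q ≈ f p q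
  ⊡-Aₗ-false f p q = trans (sum-cong-≋ (λ k → *-congˡ (reflexive (Aₗ-false k q)))) (sum-δʳ (f p) q)

  Eₗ-⊡ : ∀ {m} (x : Fin m) a (f : LMat m) p q → (Eₗ x a ⊡ f) p q ≈ b2F (does (x ≟ p) xor a) * f p q
  Eₗ-⊡ x a f p q =
    trans (sum-cong-≋ (λ k → trans (*-congʳ (*-congʳ (reflexive (Aₗ-false p k)))) (*-assoc _ _ _)))
          (sum-δ p (λ k → b2F (does (x ≟ p) xor a) * f k q))

  ⊡-Eₗ : ∀ {m} (x : Fin m) c (f : LMat m) p q → (f ⊡ Eₗ x c) p q ≈ f p q * b2F (does (x ≟ q) xor c)
  ⊡-Eₗ x c f p q =
    trans (sum-cong-≋ (λ k → trans (*-congˡ (trans (*-congʳ (reflexive (Aₗ-false k q))) (*-comm _ _)))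
                                   (sym (*-assoc _ _ _))))
          (sum-δʳ (λ k → f p k * b2F (does (x ≟ k) xor c)) q)

  valency : ℕ → Bool → Carrier
  valency m false = 1#
  valency m true  = others m

  sum-Aₗ : ∀ b {m} (x : Fin m) → sum (Aₗ b x) ≈ valency m b
  sum-Aₗ false {suc m} x =
    trans (sum-cong-≋ (λ k → trans (reflexive (Aₗ-false x k)) (sym (*-identityʳ _)))) (sum-δ x (λ _ → 1#))
  sum-Aₗ true  {suc m} x = begin
    sum (Aₗ true x)
      ≈⟨ sum-remove {i = x} (Aₗ true x) ⟩
    Aₗ true x x + sum (λ k → Aₗ true x (punchIn x k))
      ≡⟨ ≡.cong₂ _+_ (≡.cong (λ d → b2F (d xor true)) (does-≟-refl x))
                     (sum-cong-≗ λ k → ≡.cong (λ d → b2F (d xor true)) (does-≟-punchIn x k)) ⟩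
    0# + sum {m} (λ _ → 1#)
      ≈⟨ trans (+-identityˡ _) (sum-const m 1#) ⟩
    ι m * 1#
      ≈⟨ *-identityʳ _ ⟩
    others (suc m) ∎

  same : ∀ {m} {x p q : Fin (suc m)} → Position x p → Position x q → Bool
  same at       at       = true
  same at       (away _) = false
  same (away _) at       = false
  same (away i) (away j) = does (i ≟ j)

  same-position : ∀ {m} {x p q : Fin (suc m)} (P : Position x p) (Q : Position x q) → does (p ≟ q) ≡ same P Q
  same-position {x = x} at       at       = does-≟-refl x
  same-position {x = x} at       (away j) = does-≟-punchIn x j
  same-position {x = x} (away i) at       = ≡.trans (does-≟-sym (punchIn x i) x) (does-≟-punchIn x i)
  same-position {x = x} (away i) (away j) = does-punchIn≟punchIn x i j

  Aₒ : Bool → Orb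
  Aₒ false = orb 1# 0# 0# 1# 0#
  Aₒ true  = orb 0# 1# 1# (- 1#) 1#

  Eₒ : Bool → Orb
  Eₒ false = orb 1# 0# 0# 0# 0#
  Eₒ true  = orb 0# 0# 0# 1# 0#

  entry-via : ∀ {m} {f : LMat (suc m)} φ (x : Fin (suc m)) →
              (∀ {p q} (P : Position x p) (Q : Position x q) → f p q ≈ entryᵖ φ P Q) →
              ∀ p q → f p q ≈ entry φ x p q
  entry-via φ x f≈ p q = trans (f≈ (position x p) (position x q))
                               (reflexive (≡.sym (entry-position φ (position x p) (position x q))))

  entry-Aₒ : ∀ b {m} (x p q : Fin m) → Aₗ b p q ≈ entry (Aₒ b) x p q
  entry-Aₒ b {suc m} x = entry-via (Aₒ b) x λ P Q →
    trans (reflexive (≡.cong (λ d → b2F (d xor b)) (same-position P Q))) (Aᵖ b P Q)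
    where
    Aᵖ : ∀ b {p q} (P : Position x p) (Q : Position x q) → b2F (same P Q xor b) ≈ entryᵖ (Aₒ b) P Q
    Aᵖ false at       at       = refl
    Aᵖ false at       (away _) = refl
    Aᵖ false (away _) at       = refl
    Aᵖ false (away i) (away j) with does (i ≟ j)
    ... | true  = sym (trans (+-identityʳ _) (*-identityˡ 1#))
    ... | false = sym (trans (+-identityʳ _) (zeroʳ 1#))
    Aᵖ true  at       at       = refl
    Aᵖ true  at       (away _) = refl
    Aᵖ true  (away _) at       = refl
    Aᵖ true  (away i) (away j) with does (i ≟ j)
    ... | true  = sym (trans (+-congʳ (*-identityʳ (- 1#))) (-‿inverseˡ 1#))
    ... | false = sym (trans (+-congʳ (zeroʳ (- 1#))) (+-identityˡ 1#))

  entry-Eₒ : ∀ a {m} (x p q : Fin m) → Eₗ x a p q ≈ entry (Eₒ a) x p q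
  entry-Eₒ a {suc m} x = entry-via (Eₒ a) x λ P Q →
    trans (reflexive (≡.cong₂ (λ d s → b2F (d xor false) * b2F s) (same-position P Q) (side-position a P)))
          (Eᵖ a P Q)
    where
    Eᵖ : ∀ a {p q} (P : Position x p) (Q : Position x q) →
         b2F (same P Q xor false) * b2F (side a P) ≈ entryᵖ (Eₒ a) P Q
    Eᵖ false at       at       = *-identityˡ 1#
    Eᵖ false at       (away _) = zeroˡ 1#
    Eᵖ false (away _) at       = zeroˡ 0#
    Eᵖ false (away i) (away j) = trans (zeroʳ _) (sym (trans (+-identityʳ _) (zeroˡ _)))
    Eᵖ true  at       at       = zeroʳ 1#
    Eᵖ true  at       (away _) = zeroˡ 0#
    Eᵖ true  (away _) at       = zeroˡ 1#
    Eᵖ true  (away i) (away j) with does (i ≟ j)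
    ... | true  = sym (+-identityʳ _)
    ... | false = trans (zeroˡ 1#) (sym (trans (+-identityʳ _) (zeroʳ 1#)))

  Aₒ-between : Bool → Bool → Orb
  Aₒ-between false false = Aₒ false
  Aₒ-between false true  = orb 1# 1# 1# 0# 1#
  Aₒ-between true  false = orb 0# 0# 0# 0# 0#
  Aₒ-between true  true  = Aₒ true

  rowsₒ colsₒ : Bool → Orb → Orb
  rowsₒ false ψ = orb (xx ψ) (xy ψ) 0# 0# 0#
  rowsₒ true  ψ = orb 0# 0# (yx ψ) (diag ψ) (ones ψ)
  colsₒ false ψ = orb (xx ψ) 0# (yx ψ) 0# 0#
  colsₒ true  ψ = orb 0# (xy ψ) 0# (diag ψ) (ones ψ)

  Bₒ : Bool → Bool → Bool → Orb
  Bₒ a b c = colsₒ c (rowsₒ a (Aₒ-between (a xor c) b))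

  between : Bool → Bool → Bool → Carrier
  between lo hi j = b2F (lo ⇒ᵇ j) * b2F (j ⇒ᵇ hi)

  entry-Aₒ-between : ∀ lo hi {m} (x p q : Fin m) →
                     between lo hi false * Aₗ false p q + between lo hi true * Aₗ true p q
                       ≈ entry (Aₒ-between lo hi) x p q
  entry-Aₒ-between false false x p q =
    trans (solve 2 (λ a b → con 1 :* con 1 :* a :+ con 1 :* con 0 :* b := a) refl _ _) (entry-Aₒ false x p q)
  entry-Aₒ-between true  true  x p q =
    trans (solve 2 (λ a b → con 0 :* con 1 :* a :+ con 1 :* con 1 :* b := b) refl _ _) (entry-Aₒ true x p q)
  entry-Aₒ-between true  false {suc m} x p q =
    trans (solve 2 (λ a b → con 0 :* con 1 :* a :+ con 1 :* con 0 :* b := con 0) refl _ _)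
          (entry-via (Aₒ-between true false) x (λ { at at → refl ; at (away _) → refl ; (away _) at → refl
                                                 ; (away i) (away j) → sym (trans (+-identityʳ _) (zeroˡ _)) }) p q)
  entry-Aₒ-between false true  {suc m} x p q =
    trans (solve 2 (λ a b → con 1 :* con 1 :* a :+ con 1 :* con 1 :* b := a :+ b) refl _ _)
          (trans (Aₗ-complement (does (p ≟ q)))
                 (entry-via (Aₒ-between false true) x (λ { at at → refl ; at (away _) → refl ; (away _) at → refl
                                                        ; (away i) (away j) → sym (trans (+-congʳ (zeroˡ _)) (+-identityˡ _)) })
                            p q))
    where
    Aₗ-complement : ∀ d → b2F (d xor false) + b2F (d xor true) ≈ 1#
    Aₗ-complement true  = +-identityʳ 1#
    Aₗ-complement false = +-identityˡ 1#

  entry-rowsₒ : ∀ a ψ {m} (x p q : Fin m) → b2F (does (x ≟ p) xor a) * entry ψ x p q ≈ entry (rowsₒ a ψ) x p q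
  entry-rowsₒ a ψ {suc m} x = entry-via (rowsₒ a ψ) x λ P Q →
    trans (reflexive (≡.cong₂ (λ s e → b2F s * e) (side-position a P) (entry-position ψ P Q))) (rowsᵖ a P Q)
    where
    rowsᵖ : ∀ a {p q} (P : Position x p) (Q : Position x q) →
            b2F (side a P) * entryᵖ ψ P Q ≈ entryᵖ (rowsₒ a ψ) P Q
    rowsᵖ false at       at       = *-identityˡ _
    rowsᵖ false at       (away _) = *-identityˡ _
    rowsᵖ false (away _) at       = zeroˡ _
    rowsᵖ false (away i) (away j) = trans (zeroˡ _) (sym (trans (+-identityʳ _) (zeroˡ _)))
    rowsᵖ true  at       at       = zeroˡ _
    rowsᵖ true  at       (away _) = zeroˡ _
    rowsᵖ true  (away _) at       = *-identityˡ _
    rowsᵖ true  (away i) (away j) = *-identityˡ _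

  entry-colsₒ : ∀ c ψ {m} (x p q : Fin m) → entry ψ x p q * b2F (does (x ≟ q) xor c) ≈ entry (colsₒ c ψ) x p q
  entry-colsₒ c ψ {suc m} x = entry-via (colsₒ c ψ) x λ P Q →
    trans (reflexive (≡.cong₂ (λ e s → e * b2F s) (entry-position ψ P Q) (side-position c Q))) (colsᵖ c P Q)
    where
    colsᵖ : ∀ c {p q} (P : Position x p) (Q : Position x q) →
            entryᵖ ψ P Q * b2F (side c Q) ≈ entryᵖ (colsₒ c ψ) P Q
    colsᵖ false at       at       = *-identityʳ _
    colsᵖ false at       (away _) = zeroʳ _
    colsᵖ false (away _) at       = *-identityʳ _
    colsᵖ false (away i) (away j) = trans (zeroʳ _) (sym (trans (+-identityʳ _) (zeroˡ _)))
    colsᵖ true  at       at       = zeroʳ _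
    colsᵖ true  at       (away _) = *-identityʳ _
    colsᵖ true  (away _) at       = zeroʳ _
    colsᵖ true  (away i) (away j) = *-identityʳ _

  entry-Bₒ : ∀ a b c {m} (x p q : Fin m) →
             between (a xor c) b false * ((Eₗ x a ⊡ Aₗ false) ⊡ Eₗ x c) p q +
             between (a xor c) b true  * ((Eₗ x a ⊡ Aₗ true)  ⊡ Eₗ x c) p q ≈ entry (Bₒ a b c) x p q
  entry-Bₒ a b c x p q = begin
    i₀ * ((Eₗ x a ⊡ Aₗ false) ⊡ Eₗ x c) p q + i₁ * ((Eₗ x a ⊡ Aₗ true) ⊡ Eₗ x c) p q
      ≈⟨ +-cong (*-congˡ (sandwich false)) (*-congˡ (sandwich true)) ⟩
    i₀ * (sᵃ * Aₗ false p q * sᶜ) + i₁ * (sᵃ * Aₗ true p q * sᶜ)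
      ≈⟨ solve 6 (λ i₀ i₁ sa sc a₀ a₁ → i₀ :* (sa :* a₀ :* sc) :+ i₁ :* (sa :* a₁ :* sc)
                                       := sa :* (i₀ :* a₀ :+ i₁ :* a₁) :* sc)
               refl i₀ i₁ sᵃ sᶜ _ _ ⟩
    sᵃ * (i₀ * Aₗ false p q + i₁ * Aₗ true p q) * sᶜ
      ≈⟨ *-congʳ (*-congˡ (entry-Aₒ-between (a xor c) b x p q)) ⟩
    sᵃ * entry (Aₒ-between (a xor c) b) x p q * sᶜ
      ≈⟨ *-congʳ (entry-rowsₒ a (Aₒ-between (a xor c) b) x p q) ⟩
    entry (rowsₒ a (Aₒ-between (a xor c) b)) x p q * sᶜ
      ≈⟨ entry-colsₒ c (rowsₒ a (Aₒ-between (a xor c) b)) x p q ⟩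
    entry (Bₒ a b c) x p q ∎
    where
    i₀ = between (a xor c) b false
    i₁ = between (a xor c) b true
    sᵃ = b2F (does (x ≟ p) xor a)
    sᶜ = b2F (does (x ≟ q) xor c)
    sandwich : ∀ j → ((Eₗ x a ⊡ Aₗ j) ⊡ Eₗ x c) p q ≈ sᵃ * Aₗ j p q * sᶜ
    sandwich j = trans (⊡-Eₗ x c (Eₗ x a ⊡ Aₗ j) p q) (*-congʳ (Eₗ-⊡ x a (Aₗ j) p q))

  record InJ (φ : Orb) : Set ℓ where
    field
      xx≈0   : xx φ ≈ 0#
      diag≈0 : diag φ ≈ 0#

  record InJ² (φ : Orb) : Set ℓ where
    field
      inJ  : InJ φ
      xy≈0 : xy φ ≈ 0#
      yx≈0 : yx φ ≈ 0#

  record InJ³ (φ : Orb) : Set ℓ where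
    field
      inJ²   : InJ² φ
      ones≈0 : ones φ ≈ 0#

  infix 4 _∈J^_
  _∈J^_ : Orb → ℕ → Set ℓ
  φ ∈J^ zero                = ⊤
  φ ∈J^ suc zero            = InJ φ
  φ ∈J^ suc (suc zero)      = InJ² φ
  φ ∈J^ suc (suc (suc _))   = InJ³ φ

  ∈J^suc⇒InJ : ∀ l {φ} → φ ∈J^ suc l → InJ φ
  ∈J^suc⇒InJ zero                φ∈J = φ∈J
  ∈J^suc⇒InJ (suc zero)          φ∈J = InJ².inJ φ∈J
  ∈J^suc⇒InJ (suc (suc l))       φ∈J = InJ².inJ (InJ³.inJ² φ∈J)

  InJ³⇒entry≈0 : ∀ {φ} → InJ³ φ → ∀ {m} (x p q : Fin m) → entry φ x p q ≈ 0#
  InJ³⇒entry≈0 {φ} φ∈J³ {suc m} x p q = trans (reflexive (entry-position φ (position x p) (position x q)))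
                                              (vanish (position x p) (position x q))
    where
    open InJ³ φ∈J³
    open InJ² inJ²
    open InJ inJ
    vanish : ∀ {p q} (P : Position x p) (Q : Position x q) → entryᵖ φ P Q ≈ 0#
    vanish at       at       = xx≈0
    vanish at       (away _) = xy≈0
    vanish (away _) at       = yx≈0
    vanish (away _) (away _) = trans (+-cong (trans (*-congʳ diag≈0) (zeroˡ _)) ones≈0) (+-identityˡ 0#)

  private
    *≈0ˡ : ∀ {a b} → a ≈ 0# → a * b ≈ 0#
    *≈0ˡ a≈0 = trans (*-congʳ a≈0) (zeroˡ _)

    *≈0ʳ : ∀ {a b} → b ≈ 0# → a * b ≈ 0#
    *≈0ʳ b≈0 = trans (*-congˡ b≈0) (zeroʳ _)

    +≈0 : ∀ {a b} → a ≈ 0# → b ≈ 0# → a + b ≈ 0#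
    +≈0 a≈0 b≈0 = trans (+-cong a≈0 b≈0) (+-identityˡ 0#)

  module _ {κ : Carrier} (κ≈0 : κ ≈ 0#) {φ ψ : Orb} where

    private
      κ* : ∀ {a} → κ * a ≈ 0#
      κ* = *≈0ˡ κ≈0

    InJ-⋆ˡ : InJ φ → InJ (φ ⋆[ κ ] ψ)
    InJ-⋆ˡ φ∈J = record { xx≈0 = +≈0 (*≈0ˡ xx≈0) κ* ; diag≈0 = *≈0ˡ diag≈0 }
      where open InJ φ∈J

    InJ-⋆ʳ : InJ ψ → InJ (φ ⋆[ κ ] ψ)
    InJ-⋆ʳ ψ∈J = record { xx≈0 = +≈0 (*≈0ʳ xx≈0) κ* ; diag≈0 = *≈0ʳ diag≈0 }
      where open InJ ψ∈J

    InJ²-⋆ˡ : InJ² φ → InJ² (φ ⋆[ κ ] ψ)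
    InJ²-⋆ˡ φ∈J² = record
      { inJ  = InJ-⋆ˡ inJ
      ; xy≈0 = +≈0 (+≈0 (*≈0ˡ xx≈0) (*≈0ˡ xy≈0)) κ*
      ; yx≈0 = +≈0 (+≈0 (*≈0ˡ yx≈0) (*≈0ˡ diag≈0)) κ*
      }
      where
        open InJ² φ∈J²
        open InJ inJ

    InJ²-⋆ʳ : InJ² ψ → InJ² (φ ⋆[ κ ] ψ)
    InJ²-⋆ʳ ψ∈J² = record
      { inJ  = InJ-⋆ʳ inJ
      ; xy≈0 = +≈0 (+≈0 (*≈0ʳ xy≈0) (*≈0ʳ diag≈0)) κ*
      ; yx≈0 = +≈0 (+≈0 (*≈0ʳ xx≈0) (*≈0ʳ yx≈0)) κ*
      }
      where
        open InJ² ψ∈J²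
        open InJ inJ

    InJ³-⋆ˡ : InJ³ φ → InJ³ (φ ⋆[ κ ] ψ)
    InJ³-⋆ˡ φ∈J³ = record
      { inJ²   = InJ²-⋆ˡ inJ²
      ; ones≈0 = +≈0 (+≈0 (+≈0 (*≈0ˡ yx≈0) (*≈0ˡ diag≈0)) (*≈0ˡ ones≈0)) κ*
      }
      where
        open InJ³ φ∈J³
        open InJ² inJ²
        open InJ inJ

    InJ³-⋆ʳ : InJ³ ψ → InJ³ (φ ⋆[ κ ] ψ)
    InJ³-⋆ʳ ψ∈J³ = record
      { inJ²   = InJ²-⋆ʳ inJ²
      ; ones≈0 = +≈0 (+≈0 (+≈0 (*≈0ʳ xy≈0) (*≈0ʳ ones≈0)) (*≈0ʳ diag≈0)) κ*
      }
      where
        open InJ³ ψ∈J³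
        open InJ² inJ²
        open InJ inJ

    InJ-⋆-InJ : InJ φ → InJ ψ → InJ² (φ ⋆[ κ ] ψ)
    InJ-⋆-InJ φ∈J ψ∈J = record
      { inJ  = InJ-⋆ˡ φ∈J
      ; xy≈0 = +≈0 (+≈0 (*≈0ˡ (InJ.xx≈0 φ∈J)) (*≈0ʳ (InJ.diag≈0 ψ∈J))) κ*
      ; yx≈0 = +≈0 (+≈0 (*≈0ʳ (InJ.xx≈0 ψ∈J)) (*≈0ˡ (InJ.diag≈0 φ∈J))) κ*
      }

    InJ-⋆-InJ² : InJ φ → InJ² ψ → InJ³ (φ ⋆[ κ ] ψ)
    InJ-⋆-InJ² φ∈J ψ∈J² = record
      { inJ²   = InJ²-⋆ʳ ψ∈J²
      ; ones≈0 = +≈0 (+≈0 (+≈0 (*≈0ʳ (InJ².xy≈0 ψ∈J²)) (*≈0ˡ (InJ.diag≈0 φ∈J)))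
                          (*≈0ʳ (InJ.diag≈0 (InJ².inJ ψ∈J²))))
                     κ*
      }

    InJ²-⋆-InJ : InJ² φ → InJ ψ → InJ³ (φ ⋆[ κ ] ψ)
    InJ²-⋆-InJ φ∈J² ψ∈J = record
      { inJ²   = InJ²-⋆ˡ φ∈J²
      ; ones≈0 = +≈0 (+≈0 (+≈0 (*≈0ˡ (InJ².yx≈0 φ∈J²)) (*≈0ˡ (InJ.diag≈0 (InJ².inJ φ∈J²))))
                          (*≈0ʳ (InJ.diag≈0 ψ∈J)))
                     κ*
      }

  ∈J^-⋆ : ∀ {κ} → κ ≈ 0# → ∀ l l' {φ ψ} → φ ∈J^ l → ψ ∈J^ l' → φ ⋆[ κ ] ψ ∈J^ (l ℕ.+ l')
  ∈J^-⋆ κ≈0 zero                zero                _   _   = tt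
  ∈J^-⋆ κ≈0 zero                (suc zero)          _   ψ∈ = InJ-⋆ʳ κ≈0 ψ∈
  ∈J^-⋆ κ≈0 zero                (suc (suc zero))    _   ψ∈ = InJ²-⋆ʳ κ≈0 ψ∈
  ∈J^-⋆ κ≈0 zero                (suc (suc (suc _))) _   ψ∈ = InJ³-⋆ʳ κ≈0 ψ∈
  ∈J^-⋆ κ≈0 (suc zero)          zero                φ∈ _   = InJ-⋆ˡ κ≈0 φ∈
  ∈J^-⋆ κ≈0 (suc zero)          (suc zero)          φ∈ ψ∈ = InJ-⋆-InJ κ≈0 φ∈ ψ∈
  ∈J^-⋆ κ≈0 (suc zero)          (suc (suc zero))    φ∈ ψ∈ = InJ-⋆-InJ² κ≈0 φ∈ ψ∈
  ∈J^-⋆ κ≈0 (suc zero)          (suc (suc (suc _))) _   ψ∈ = InJ³-⋆ʳ κ≈0 ψ∈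
  ∈J^-⋆ κ≈0 (suc (suc zero))    zero                φ∈ _   = InJ²-⋆ˡ κ≈0 φ∈
  ∈J^-⋆ κ≈0 (suc (suc zero))    (suc zero)          φ∈ ψ∈ = InJ²-⋆-InJ κ≈0 φ∈ ψ∈
  ∈J^-⋆ κ≈0 (suc (suc zero))    (suc (suc zero))    φ∈ ψ∈ = InJ²-⋆-InJ κ≈0 φ∈ (InJ².inJ ψ∈)
  ∈J^-⋆ κ≈0 (suc (suc zero))    (suc (suc (suc _))) _   ψ∈ = InJ³-⋆ʳ κ≈0 ψ∈
  ∈J^-⋆ κ≈0 (suc (suc (suc _))) _                   φ∈ _   = InJ³-⋆ˡ κ≈0 φ∈

  Bₒ-radical : ∀ a c → (a ≡ false → c ≡ true) → InJ (Bₒ a true c)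
  Bₒ-radical false true  _ = record { xx≈0 = refl ; diag≈0 = refl }
  Bₒ-radical true  false _ = record { xx≈0 = refl ; diag≈0 = refl }
  Bₒ-radical true  true  _ = record { xx≈0 = refl ; diag≈0 = refl }
  Bₒ-radical false false a≡false⇒c≡true with () ← a≡false⇒c≡true ≡.refl

  -- The last argument records m > 2: for m = 2 there is a single point off x, where the
  -- diag and ones parts of an entry cannot be told apart and Bₒ true true true is not admissible.
  coef : Orb → Bool → Bool → Bool → Bool → Carrier
  coef φ false false false _     = xx φ
  coef φ false true  true  _     = xy φ
  coef φ true  true  false _     = yx φ
  coef φ true  false true  true  = diag φ
  coef φ true  false true  false = diag φ + ones φ
  coef φ true  true  true  true  = ones φ
  coef φ _     _     _     _     = 0#

  coef-inadmissible : ∀ φ a b c big → admissible a b c big ≡ false → coef φ a b c big ≈ 0#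
  coef-inadmissible φ false false true  _     _ = refl
  coef-inadmissible φ false true  false _     _ = refl
  coef-inadmissible φ true  false false _     _ = refl
  coef-inadmissible φ true  true  true  false _ = refl

  coef-radical : ∀ φ a c → InJ φ → coef φ a false c true ≈ 0#
  coef-radical φ false false φ∈J = InJ.xx≈0 φ∈J
  coef-radical φ false true  _   = refl
  coef-radical φ true  false _   = refl
  coef-radical φ true  true  φ∈J = InJ.diag≈0 φ∈J

  decomposeᵖ : ∀ φ {m} {x p q : Fin (suc m)} (P : Position x p) (Q : Position x q) →
               entryᵖ φ P Q ≈ Σ³ (λ a b c → coef φ a b c (2 <ᵇ suc m) * entryᵖ (Bₒ a b c) P Q)
  decomposeᵖ φ {m} at at = solve 5 (λ X Y Z D O →
    X := ((X :* con 1 :+ con 0 :* con 0) :+ (con 0 :* con 1 :+ Y :* con 0))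
         :+ ((con 0 :* con 0 :+ D :* con 0) :+ (Z :* con 0 :+ O :* con 0)))
    refl (xx φ) (xy φ) (yx φ) (coef φ true false true (2 <ᵇ suc m)) (coef φ true true true (2 <ᵇ suc m))
  decomposeᵖ φ {m} at (away _) = solve 5 (λ X Y Z D O →
    Y := ((X :* con 0 :+ con 0 :* con 0) :+ (con 0 :* con 0 :+ Y :* con 1))
         :+ ((con 0 :* con 0 :+ D :* con 0) :+ (Z :* con 0 :+ O :* con 0)))
    refl (xx φ) (xy φ) (yx φ) (coef φ true false true (2 <ᵇ suc m)) (coef φ true true true (2 <ᵇ suc m))
  decomposeᵖ φ {m} (away _) at = solve 5 (λ X Y Z D O →
    Z := ((X :* con 0 :+ con 0 :* con 0) :+ (con 0 :* con 0 :+ Y :* con 0))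
         :+ ((con 0 :* con 0 :+ D :* con 0) :+ (Z :* con 1 :+ O :* con 0)))
    refl (xx φ) (xy φ) (yx φ) (coef φ true false true (2 <ᵇ suc m)) (coef φ true true true (2 <ᵇ suc m))
  decomposeᵖ φ {suc zero} (away zero) (away zero) = solve 5 (λ X Y Z D O →
    D :* con 1 :+ O := ((X :* (con 0 :* con 1 :+ con 0) :+ con 0 :* (con 0 :* con 1 :+ con 0))
                        :+ (con 0 :* (con 0 :* con 1 :+ con 0) :+ Y :* (con 0 :* con 1 :+ con 0)))
                       :+ ((con 0 :* (con 0 :* con 1 :+ con 0) :+ (D :+ O) :* (con 1 :* con 1 :+ con 0))
                           :+ (Z :* (con 0 :* con 1 :+ con 0) :+ con 0 :* (con 0 :* con 1 :+ con 1))))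
    refl (xx φ) (xy φ) (yx φ) (diag φ) (ones φ)
  decomposeᵖ φ {suc (suc m)} (away i) (away j) = solve 6 (λ X Y Z D O d →
    D :* d :+ O := ((X :* (con 0 :* d :+ con 0) :+ con 0 :* (con 0 :* d :+ con 0))
                    :+ (con 0 :* (con 0 :* d :+ con 0) :+ Y :* (con 0 :* d :+ con 0)))
                   :+ ((con 0 :* (con 0 :* d :+ con 0) :+ D :* (con 1 :* d :+ con 0))
                       :+ (Z :* (con 0 :* d :+ con 0) :+ O :* (con 0 :* d :+ con 1))))
    refl (xx φ) (xy φ) (yx φ) (diag φ) (ones φ) (δ i j)

  decompose : ∀ φ {m} (x p q : Fin m) →
              entry φ x p q ≈ Σ³ (λ a b c → coef φ a b c (2 <ᵇ m) * entry (Bₒ a b c) x p q)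
  decompose φ {suc m} x p q = begin
    entry φ x p q
      ≡⟨ entry-position φ P Q ⟩
    entryᵖ φ P Q
      ≈⟨ decomposeᵖ φ P Q ⟩
    Σ³ (λ a b c → coef φ a b c (2 <ᵇ suc m) * entryᵖ (Bₒ a b c) P Q)
      ≈⟨ Σ³-cong (λ a b c → *-congˡ {coef φ a b c (2 <ᵇ suc m)} (reflexive (entry-position (Bₒ a b c) P Q))) ⟨
    Σ³ (λ a b c → coef φ a b c (2 <ᵇ suc m) * entry (Bₒ a b c) x p q) ∎
    where
    P = position x p
    Q = position x q

  pairₒ : Carrier → Bool → Bool → Orb → Orb
  pairₒ κ s e ψ = Bₒ s e (s ∧ not e) ⋆[ κ ] (Bₒ (s ∧ not e) e s ⋆[ κ ] ψ)

  module _ (κ : Carrier) where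

    private
      xx-outside : ∀ e φ → xx (Bₒ false e false ⋆[ κ ] φ) ≈ xx φ
      xx-outside false φ = solve 3 (λ X Y K → con 1 :* X :+ K :* (con 0 :* Y) := X) refl (xx φ) (yx φ) κ
      xx-outside true  φ = solve 3 (λ X Y K → con 1 :* X :+ K :* (con 0 :* Y) := X) refl (xx φ) (yx φ) κ

      diag-away : ∀ φ → diag (Bₒ true false true ⋆[ κ ] φ) ≈ diag φ
      diag-away φ = *-identityˡ (diag φ)

      ones-away : ∀ φ → ones (Bₒ true false true ⋆[ κ ] φ) ≈ ones φ
      ones-away φ = solve 4 (λ X O D K → con 0 :* X :+ con 1 :* O :+ con 0 :* D :+ K :* (con 0 :* O) := O)
                          refl (xy φ) (ones φ) (diag φ) κ

    pairₒ-outside : ∀ e ψ → xx (pairₒ κ false e ψ) ≈ xx ψ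
    pairₒ-outside e ψ = trans (xx-outside e (Bₒ false e false ⋆[ κ ] ψ)) (xx-outside e ψ)

    pairₒ-away : ∀ ψ → diag (pairₒ κ true false ψ) ≈ diag ψ × ones (pairₒ κ true false ψ) ≈ ones ψ
    pairₒ-away ψ = trans (diag-away φ) (diag-away ψ) , trans (ones-away φ) (ones-away ψ)
      where φ = Bₒ true false true ⋆[ κ ] ψ

    pairₒ-at : ∀ ψ → diag (pairₒ κ true true ψ) ≈ 0# × ones (pairₒ κ true true ψ) ≈ diag ψ + κ * ones ψ
    pairₒ-at ψ = zeroˡ _ , solve 6 (λ X O D K Y Z →
      con 1 :* (con 0 :* X :+ con 1 :* D :+ K :* (con 1 :* O)) :+ con 0 :* Y :+ con 0 :* Z :+ K :* (con 0 :* Y)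
        := D :+ K :* O)
      refl (xy ψ) (ones ψ) (diag ψ) κ (ones (Bₒ false true true ⋆[ κ ] ψ)) (diag (Bₒ false true true ⋆[ κ ] ψ))
module MatrixAlgebra {c ℓ} (F : Field c ℓ) {n : ℕ} (u : Fin n → ℕ) where

  open Field F hiding (zero)
  open BigOperators F
  open Matrices F u hiding (b2F; ι; sumL)
  open import Relation.Binary.Reasoning.Setoid setoid

  private
    pts = allPt n u

  ≋-refl : ∀ {M} → M ≋ M
  ≋-refl v w = refl

  ≋-sym : ∀ {M N} → M ≋ N → N ≋ M
  ≋-sym M≋N v w = sym (M≋N v w)

  ≋-trans : ∀ {M N O} → M ≋ N → N ≋ O → M ≋ O
  ≋-trans M≋N N≋O v w = trans (M≋N v w) (N≋O v w)

  ≡⇒≋ : ∀ {M N} → M ≡ N → M ≋ N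
  ≡⇒≋ ≡.refl = ≋-refl

  ⊠-cong : ∀ {M M′ N N′} → M ≋ M′ → N ≋ N′ → (M ⊠ N) ≋ (M′ ⊠ N′)
  ⊠-cong M≋M′ N≋N′ v w = ∑-cong pts (λ z → *-cong (M≋M′ v z) (N≋N′ z w))

  ⊠-distribˡ : ∀ M N O → (M ⊠ (N ⊞ O)) ≋ ((M ⊠ N) ⊞ (M ⊠ O))
  ⊠-distribˡ M N O v w = trans (∑-cong pts (λ z → distribˡ _ _ _)) (∑-+ pts _ _)

  ⊠-distribʳ : ∀ M N O → ((M ⊞ N) ⊠ O) ≋ ((M ⊠ O) ⊞ (N ⊠ O))
  ⊠-distribʳ M N O v w = trans (∑-cong pts (λ z → distribʳ _ _ _)) (∑-+ pts _ _)

  ⊠-scaleˡ : ∀ a M N → ((a · M) ⊠ N) ≋ (a · (M ⊠ N))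
  ⊠-scaleˡ a M N v w = trans (∑-cong pts (λ z → *-assoc _ _ _)) (∑-*ˡ pts a _)

  ⊠-scaleʳ : ∀ a M N → (M ⊠ (a · N)) ≋ (a · (M ⊠ N))
  ⊠-scaleʳ a M N v w = trans (∑-cong pts (λ z → x∙yz≈y∙xz _ a _)) (∑-*ˡ pts a _)
    where open import Algebra.Properties.CommutativeSemigroup *-commutativeSemigroup using (x∙yz≈y∙xz)

  ⊠-zeroˡ : ∀ M → (𝟘 ⊠ M) ≋ 𝟘
  ⊠-zeroˡ M v w = ∑-zero pts (λ z → zeroˡ _)

  ⊠-zeroʳ : ∀ M → (M ⊠ 𝟘) ≋ 𝟘
  ⊠-zeroʳ M v w = ∑-zero pts (λ z → zeroʳ _)

  ⊠-negʳ : ∀ M N → (M ⊠ (- N ᴹ)) ≋ (- (M ⊠ N) ᴹ)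
  ⊠-negʳ M N v w = trans (∑-cong pts (λ z → sym (-‿distribʳ-* _ _))) (∑-neg pts _)
    where open import Algebra.Properties.Ring ring using (-‿distribʳ-*)

  ⊠-assoc : ∀ M N O → ((M ⊠ N) ⊠ O) ≋ (M ⊠ (N ⊠ O))
  ⊠-assoc M N O v w = begin
    ∑ pts (λ z → ∑ pts (λ y → M v y * N y z) * O z w)   ≈⟨ ∑-cong pts (λ z → sym (∑-*ʳ pts _ _)) ⟩
    ∑ pts (λ z → ∑ pts (λ y → M v y * N y z * O z w))   ≈⟨ ∑-swap pts pts _ ⟩
    ∑ pts (λ y → ∑ pts (λ z → M v y * N y z * O z w))   ≈⟨ ∑-cong pts (λ y → trans (∑-cong pts (λ z → *-assoc _ _ _))
                                                                                 (∑-*ˡ pts _ _)) ⟩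
    ∑ pts (λ y → M v y * ∑ pts (λ z → N y z * O z w))   ∎

module Tensor {c ℓ} (F : Field c ℓ) {n : ℕ} (u : Fin n → ℕ) (x : Pt n u) where

  open Field F hiding (zero)
  open BigOperators F
  open OrbitAlgebra F
  open Matrices F u hiding (b2F; ι; sumL)
  open MatrixAlgebra F u
  open import Relation.Binary.Reasoning.Setoid setoid

  tensor : ((t : Fin n) → LMat (u t)) → Mat
  tensor f v w = ∏ (λ t → f t (v t) (w t))

  tensor-cong : ∀ {f g : (t : Fin n) → LMat (u t)} → (∀ t p q → f t p q ≈ g t p q) → tensor f ≋ tensor g
  tensor-cong f≈g v w = ∏-cong (λ t → f≈g t (v t) (w t))

  tensor-⊠ : ∀ f g → (tensor f ⊠ tensor g) ≋ tensor (λ t → f t ⊡ g t)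
  tensor-⊠ f g v w = begin
    ∑ (allPt n u) (λ z → tensor f v z * tensor g z w)
      ≈⟨ ∑-cong (allPt n u) (λ z → sym (∏-distrib-* (λ t → f t (v t) (z t)) (λ t → g t (z t) (w t)))) ⟩
    ∑ (allPt n u) (λ z → ∏ (λ t → f t (v t) (z t) * g t (z t) (w t)))
      ≈⟨ ∑-allPt n u (λ t k → f t (v t) k * g t k (w t)) ⟩
    tensor (λ t → f t ⊡ g t) v w ∎

  ⟦_⟧ : ((t : Fin n) → Orb) → Mat
  ⟦ Φ ⟧ = tensor (λ t → entry (Φ t) (x t))

  _⊛_ : ((t : Fin n) → Orb) → ((t : Fin n) → Orb) → ((t : Fin n) → Orb)
  (Φ ⊛ Ψ) t = Φ t ⋆[ others (u t) ] Ψ t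

  ⟦⟧-⊠ : ∀ Φ Ψ → (⟦ Φ ⟧ ⊠ ⟦ Ψ ⟧) ≋ ⟦ Φ ⊛ Ψ ⟧
  ⟦⟧-⊠ Φ Ψ = ≋-trans (tensor-⊠ (λ t → entry (Φ t) (x t)) (λ t → entry (Ψ t) (x t)))
                     (tensor-cong (λ t → entry-⋆ (Φ t) (Ψ t) (x t)))

  Rᵇ-tensor : ∀ g v w → b2F (Rᵇ g v w) ≈ tensor (λ t → Aₗ (lookup g t)) v w
  Rᵇ-tensor g v w = trans (reflexive (≡.cong b2F (Rᵇ≡and-agrees g v w))) (b2F-and (agrees g v w) id)

  A-tensor : ∀ g → A g ≋ tensor (λ t → Aₗ (lookup g t))
  A-tensor g v w = trans (reflexive (b2F≡ {u = u} (Rᵇ g v w))) (Rᵇ-tensor g v w)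

  ∅-tensor : tensor (λ t → Aₗ (lookup (replicate n false) t)) ≋ tensor (λ _ → Aₗ false)
  ∅-tensor = tensor-cong (λ t p q → reflexive (≡.cong (λ b → Aₗ b p q) (lookup-replicate t false)))

  𝟙-tensor : 𝟙 ≋ tensor (λ _ → Aₗ false)
  𝟙-tensor = ≋-trans (A-tensor (replicate n false)) ∅-tensor

  E*-tensor : ∀ g → E* x g ≋ tensor (λ t → Eₗ (x t) (lookup g t))
  E*-tensor g v w = begin
    Matrices.b2F F u (Rᵇ ∅ v w ∧ Rᵇ g x v)
      ≡⟨ b2F≡ {u = u} (Rᵇ ∅ v w ∧ Rᵇ g x v) ⟩
    b2F (Rᵇ ∅ v w ∧ Rᵇ g x v)
      ≈⟨ b2F-∧ (Rᵇ ∅ v w) (Rᵇ g x v) ⟩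
    b2F (Rᵇ ∅ v w) * b2F (Rᵇ g x v)
      ≈⟨ *-cong (trans (Rᵇ-tensor ∅ v w) (∅-tensor v w)) (Rᵇ-tensor g x v) ⟩
    tensor (λ _ → Aₗ false) v w * tensor (λ t → Aₗ (lookup g t)) x v
      ≈⟨ ∏-distrib-* (λ t → Aₗ false (v t) (w t)) (λ t → Aₗ (lookup g t) (x t) (v t)) ⟨
    tensor (λ t → Eₗ (x t) (lookup g t)) v w ∎
    where ∅ = replicate n false

  A-orbital : ∀ g → A g ≋ ⟦ Aₒ ∘ lookup g ⟧
  A-orbital g = ≋-trans (A-tensor g) (tensor-cong (λ t → entry-Aₒ (lookup g t) (x t)))

  E*-orbital : ∀ g → E* x g ≋ ⟦ Eₒ ∘ lookup g ⟧
  E*-orbital g = ≋-trans (E*-tensor g) (tensor-cong (λ t → entry-Eₒ (lookup g t) (x t)))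

  𝟙-orbital : 𝟙 ≋ ⟦ (λ _ → Aₒ false) ⟧
  𝟙-orbital = ≋-trans 𝟙-tensor (tensor-cong (λ t → entry-Aₒ false (x t)))

  𝟙-⊠-tensor : ∀ f → (𝟙 ⊠ tensor f) ≋ tensor f
  𝟙-⊠-tensor f = ≋-trans (⊠-cong 𝟙-tensor ≋-refl)
                         (≋-trans (tensor-⊠ (λ _ → Aₗ false) f) (tensor-cong (λ t → Aₗ-false-⊡ (f t))))

  tensor-⊠-𝟙 : ∀ f → (tensor f ⊠ 𝟙) ≋ tensor f
  tensor-⊠-𝟙 f = ≋-trans (⊠-cong ≋-refl 𝟙-tensor)
                         (≋-trans (tensor-⊠ f (λ _ → Aₗ false)) (tensor-cong (λ t → ⊡-Aₗ-false (f t))))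

  b2F-⊆? : ∀ (p q : Subset n) → b2F (does (p ⊆? q)) ≈ ∏ (λ t → b2F (lookup p t ⇒ᵇ lookup q t))
  b2F-⊆? p q = trans (reflexive (≡.cong b2F (does-⊆? p q))) (b2F-and (λ t → lookup p t ⇒ᵇ lookup q t) id)

  b2F-between : ∀ (lo j hi : Subset n) →
                b2F (does ((lo ⊆? j) ×-dec (j ⊆? hi))) ≈ ∏ (λ t → between (lookup lo t) (lookup hi t) (lookup j t))
  b2F-between lo j hi = begin
    b2F (does (lo ⊆? j) ∧ does (j ⊆? hi))                   ≈⟨ b2F-∧ (does (lo ⊆? j)) (does (j ⊆? hi)) ⟩
    b2F (does (lo ⊆? j)) * b2F (does (j ⊆? hi))            ≈⟨ *-cong (b2F-⊆? lo j) (b2F-⊆? j hi) ⟩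
    ∏ (λ t → b2F (lookup lo t ⇒ᵇ lookup j t)) * ∏ (λ t → b2F (lookup j t ⇒ᵇ lookup hi t))
      ≈⟨ ∏-distrib-* (λ t → b2F (lookup lo t ⇒ᵇ lookup j t)) (λ t → b2F (lookup j t ⇒ᵇ lookup hi t)) ⟨
    ∏ (λ t → between (lookup lo t) (lookup hi t) (lookup j t)) ∎

  EAE-tensor : ∀ a j c → ((E* x a ⊠ A j) ⊠ E* x c) ≋
                         tensor (λ t → (Eₗ (x t) (lookup a t) ⊡ Aₗ (lookup j t)) ⊡ Eₗ (x t) (lookup c t))
  EAE-tensor a j c = ≋-trans (⊠-cong (≋-trans (⊠-cong (E*-tensor a) (A-tensor j)) (tensor-⊠ Eᵃ Aʲ)) (E*-tensor c))
                             (tensor-⊠ (λ t → Eᵃ t ⊡ Aʲ t) Eᶜ)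
    where
    Eᵃ Aʲ Eᶜ : (t : Fin n) → LMat (u t)
    Eᵃ t = Eₗ (x t) (lookup a t)
    Aʲ t = Aₗ (lookup j t)
    Eᶜ t = Eₗ (x t) (lookup c t)

  B-orbital : ∀ a b c → B x a b c ≋ ⟦ (λ t → Bₒ (lookup a t) (lookup b t) (lookup c t)) ⟧
  B-orbital a b c v w = begin
    ∑ (filter P? (allSubsets n)) (λ j → ((E* x a ⊠ A j) ⊠ E* x c) v w)
      ≈⟨ ∑-filter P? (allSubsets n) _ ⟩
    ∑ (allSubsets n) (λ j → b2F (does (P? j)) * ((E* x a ⊠ A j) ⊠ E* x c) v w)
      ≈⟨ ∑-cong (allSubsets n) (λ j → trans (*-cong (b2F-between (a ⊕ c) j b) (EAE-tensor a j c v w))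
                                            (sym (∏-distrib-* (λ t → between (lookup (a ⊕ c) t) (lookup b t) (lookup j t))
                                                               (λ t → local t (lookup j t))))) ⟩
    ∑ (allSubsets n) (λ j → ∏ (λ t → h (lookup (a ⊕ c) t) t (lookup j t)))
      ≈⟨ ∑-allSubsets n (λ t → h (lookup (a ⊕ c) t) t) ⟩
    ∏ (λ t → Σᵇ (h (lookup (a ⊕ c) t) t))
      ≈⟨ ∏-cong (λ t → trans (reflexive (≡.cong (λ lo → Σᵇ (h lo t)) (lookup-⊕ a c t)))
                             (entry-Bₒ (lookup a t) (lookup b t) (lookup c t) (x t) (v t) (w t))) ⟩
    ⟦ (λ t → Bₒ (lookup a t) (lookup b t) (lookup c t)) ⟧ v w ∎
    where
    P? = λ j → ((a ⊕ c) ⊆? j) ×-dec (j ⊆? b)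
    local : (t : Fin n) → Bool → Carrier
    local t j = ((Eₗ (x t) (lookup a t) ⊡ Aₗ j) ⊡ Eₗ (x t) (lookup c t)) (v t) (w t)
    h : Bool → (t : Fin n) → Bool → Carrier
    h lo t j = between lo (lookup b t) j * local t j

  ι-k : ∀ g → Matrices.ι F u (k x g) ≈ ∏ (λ t → valency (u t) (lookup g t))
  ι-k g = begin
    Matrices.ι F u (k x g)
      ≡⟨ ι≡ {u = u} (k x g) ⟩
    ι (k x g)
      ≈⟨ ι-length-filter (λ w → Rᵇ g x w Bool.≟ true) (allPt n u) ⟩
    ∑ (allPt n u) (λ w → b2F (does (Rᵇ g x w Bool.≟ true)))
      ≈⟨ ∑-cong (allPt n u) (λ w → trans (reflexive (≡.cong b2F (does-≟true (Rᵇ g x w))))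
                                         (Rᵇ-tensor g x w)) ⟩
    ∑ (allPt n u) (λ w → ∏ (λ t → Aₗ (lookup g t) (x t) (w t)))
      ≈⟨ ∑-allPt n u (λ t → Aₗ (lookup g t) (x t)) ⟩
    ∏ (λ t → sum (Aₗ (lookup g t) (x t)))
      ≈⟨ ∏-cong (λ t → sum-Aₗ (lookup g t) (x t)) ⟩
    ∏ (λ t → valency (u t) (lookup g t)) ∎
    where
    does-≟true : ∀ b → does (b Bool.≟ true) ≡ b
    does-≟true true  = ≡.refl
    does-≟true false = ≡.refl

module Filtration {c ℓ} (F : Field c ℓ) {n : ℕ} (u : Fin n → ℕ) (u≥2 : ∀ a → 2 ≤ u a) (x : Pt n u)
                  (S : Subset n) (S⇔ : ∀ a → (a ∈ S) ⇔ Field._≈_ F (Matrices.ι F u (u a)) (Field.1# F)) where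

  open Field F hiding (zero)
  open BigOperators F
  open OrbitAlgebra F
  open Matrices F u hiding (b2F; ι; sumL)
  open MatrixAlgebra F u
  open Tensor F u x
  open import Relation.Binary.Reasoning.Setoid setoid

  ∈S⇒ι≈1 : ∀ {t} → t ∈ S → ι (u t) ≈ 1#
  ∈S⇒ι≈1 {t} t∈S = trans (reflexive (≡.sym (ι≡ {u = u} (u t)))) (Equivalence.to (S⇔ t) t∈S)

  ∈S⇒others≈0 : ∀ {t} → t ∈ S → others (u t) ≈ 0#
  ∈S⇒others≈0 {t} t∈S = others≈0 (u t) (u≥2 t) (∈S⇒ι≈1 t∈S)
    where
    others≈0 : ∀ m → 2 ≤ m → ι m ≈ 1# → others m ≈ 0#
    others≈0 (suc m) _ = ι-suc≈1⇒ι≈0 m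

  others≈0⇒∈S : ∀ t → others (u t) ≈ 0# → t ∈ S
  others≈0⇒∈S t κ≈0 =
    Equivalence.from (S⇔ t) (trans (reflexive (ι≡ {u = u} (u t))) (ι≈1 (u t) (u≥2 t) κ≈0))
    where
    ι≈1 : ∀ m → 2 ≤ m → others m ≈ 0# → ι m ≈ 1#
    ι≈1 (suc m) _ ι≈0 = trans (+-congˡ ι≈0) (+-identityʳ 1#)

  ∈S⇒2<u : ∀ {t} → t ∈ S → (2 <ᵇ u t) ≡ true
  ∈S⇒2<u {t} t∈S = big (u t) (u≥2 t) (∈S⇒ι≈1 t∈S)
    where
    big : ∀ m → 2 ≤ m → ι m ≈ 1# → (2 <ᵇ m) ≡ true
    big (suc zero)          (s≤s ())
    big (suc (suc zero))    _ ι2≈1 = contradiction (trans (sym (+-identityʳ 1#)) (ι-suc≈1⇒ι≈0 1 ι2≈1)) 1≉0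
    big (suc (suc (suc m))) _ _    = ≡.refl

  meets-S⇒k≈0 : ∀ b {t} → lookup b t ≡ true → t ∈ S → Matrices.ι F u (k x b) ≈ 0#
  meets-S⇒k≈0 b {t} bt t∈S = trans (ι-k b) (∏-zero (λ i → valency (u i) (lookup b i)) t
                                       (trans (reflexive (≡.cong (valency (u t)) bt)) (∈S⇒others≈0 t∈S)))

  k≈0⇒meets-S : ∀ b → Matrices.ι F u (k x b) ≈ 0# → ∃ λ t → lookup b t ≡ true × t ∈ S
  k≈0⇒meets-S b kb≈0 with any? (λ t → (lookup b t Bool.≟ true) ×-dec (t ∈? S))
  ... | yes found = found
  ... | no none   = contradiction (trans (sym (ι-k b)) kb≈0) (∏-nonzero _ valency≉0)
    where
    valency≉0 : ∀ t → ¬ valency (u t) (lookup b t) ≈ 0#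
    valency≉0 t with lookup b t in bt
    ... | false = 1≉0
    ... | true  = λ κ≈0 → none (t , bt , others≈0⇒∈S t κ≈0)

  data Fil (r : ℕ) : Mat → Set (c ⊔ ℓ) where
    graded : ∀ Φ (lv : Fin n → ℕ) → (∀ {t} → t ∈ S → Φ t ∈J^ lv t) → r ≤ sumOver S lv → Fil r ⟦ Φ ⟧
    zer    : Fil r 𝟘
    add    : ∀ {M N} → Fil r M → Fil r N → Fil r (M ⊞ N)
    scal   : ∀ a {M} → Fil r M → Fil r (a · M)
    resp   : ∀ {M N} → Fil r M → M ≋ N → Fil r N

  ⟦⟧∈Fil0 : ∀ Φ → Fil 0 ⟦ Φ ⟧
  ⟦⟧∈Fil0 Φ = graded Φ (λ _ → 0) (λ _ → tt) z≤n

  Fil-⊠-graded : ∀ {r s} Φ lv → (∀ {t} → t ∈ S → Φ t ∈J^ lv t) → r ≤ sumOver S lv →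
                 ∀ {N} → Fil s N → Fil (r ℕ.+ s) (⟦ Φ ⟧ ⊠ N)
  Fil-⊠-graded Φ lv Φ∈ r≤ (graded Ψ lv′ Ψ∈ s≤) =
    resp (graded (Φ ⊛ Ψ) (λ t → lv t ℕ.+ lv′ t)
                 (λ t∈S → ∈J^-⋆ (∈S⇒others≈0 t∈S) (lv _) (lv′ _) (Φ∈ t∈S) (Ψ∈ t∈S))
                 (ℕ.≤-trans (ℕ.+-mono-≤ r≤ s≤) (ℕ.≤-reflexive (≡.sym (sumOver-+ S lv lv′)))))
         (≋-sym (⟦⟧-⊠ Φ Ψ))
  Fil-⊠-graded Φ lv Φ∈ r≤ zer        = resp zer (≋-sym (⊠-zeroʳ _))
  Fil-⊠-graded Φ lv Φ∈ r≤ (add N N′) = resp (add (Fil-⊠-graded Φ lv Φ∈ r≤ N) (Fil-⊠-graded Φ lv Φ∈ r≤ N′))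
                                            (≋-sym (⊠-distribˡ _ _ _))
  Fil-⊠-graded Φ lv Φ∈ r≤ (scal a N) = resp (scal a (Fil-⊠-graded Φ lv Φ∈ r≤ N)) (≋-sym (⊠-scaleʳ _ _ _))
  Fil-⊠-graded Φ lv Φ∈ r≤ (resp N e) = resp (Fil-⊠-graded Φ lv Φ∈ r≤ N) (⊠-cong ≋-refl e)

  Fil-⊠ : ∀ {r s M N} → Fil r M → Fil s N → Fil (r ℕ.+ s) (M ⊠ N)
  Fil-⊠ (graded Φ lv Φ∈ r≤) N = Fil-⊠-graded Φ lv Φ∈ r≤ N
  Fil-⊠ zer        N = resp zer (≋-sym (⊠-zeroˡ _))
  Fil-⊠ (add M M′) N = resp (add (Fil-⊠ M N) (Fil-⊠ M′ N)) (≋-sym (⊠-distribʳ _ _ _))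
  Fil-⊠ (scal a M) N = resp (scal a (Fil-⊠ M N)) (≋-sym (⊠-scaleˡ _ _ _))
  Fil-⊠ (resp M e) N = resp (Fil-⊠ M N) (⊠-cong e ≋-refl)

  𝟙∈Fil0 : Fil 0 𝟙
  𝟙∈Fil0 = resp (⟦⟧∈Fil0 _) (≋-sym 𝟙-orbital)

  𝟙-⊠-Fil : ∀ {r M} → Fil r M → (𝟙 ⊠ M) ≋ M
  𝟙-⊠-Fil (graded Φ _ _ _) = 𝟙-⊠-tensor (λ t → entry (Φ t) (x t))
  𝟙-⊠-Fil zer              = ⊠-zeroʳ 𝟙
  𝟙-⊠-Fil (add M N)        = ≋-trans (⊠-distribˡ _ _ _) (λ v w → +-cong (𝟙-⊠-Fil M v w) (𝟙-⊠-Fil N v w))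
  𝟙-⊠-Fil (scal a M)       = ≋-trans (⊠-scaleʳ _ _ _) (λ v w → *-congˡ (𝟙-⊠-Fil M v w))
  𝟙-⊠-Fil (resp M e)       = ≋-trans (⊠-cong ≋-refl (≋-sym e)) (≋-trans (𝟙-⊠-Fil M) e)

  Fil-⊠-𝟙 : ∀ {r M} → Fil r M → (M ⊠ 𝟙) ≋ M
  Fil-⊠-𝟙 (graded Φ _ _ _) = tensor-⊠-𝟙 (λ t → entry (Φ t) (x t))
  Fil-⊠-𝟙 zer              = ⊠-zeroˡ 𝟙
  Fil-⊠-𝟙 (add M N)        = ≋-trans (⊠-distribʳ _ _ _) (λ v w → +-cong (Fil-⊠-𝟙 M v w) (Fil-⊠-𝟙 N v w))
  Fil-⊠-𝟙 (scal a M)       = ≋-trans (⊠-scaleˡ _ _ _) (λ v w → *-congˡ (Fil-⊠-𝟙 M v w))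
  Fil-⊠-𝟙 (resp M e)       = ≋-trans (⊠-cong (≋-sym e) ≋-refl) (≋-trans (Fil-⊠-𝟙 M) e)

  Fil-vanishes : ∀ {M} → Fil (suc (2 ℕ.* ∣ S ∣)) M → M ≋ 𝟘
  Fil-vanishes (graded Φ lv Φ∈ 2N<) v w with pigeonhole 2 S lv 2N<
  ... | t , t∈S , 2<lv = ∏-zero _ t (InJ³⇒entry≈0 (InJ³-at (lv t) 2<lv (Φ∈ t∈S)) (x t) (v t) (w t))
    where
    InJ³-at : ∀ l {φ} → 2 < l → φ ∈J^ l → InJ³ φ
    InJ³-at (suc (suc (suc _))) _              φ∈J³ = φ∈J³
    InJ³-at (suc zero)          (s≤s ())       _
    InJ³-at (suc (suc zero))    (s≤s (s≤s ())) _
  Fil-vanishes zer        v w = refl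
  Fil-vanishes (add M N)  v w = trans (+-cong (Fil-vanishes M v w) (Fil-vanishes N v w)) (+-identityˡ 0#)
  Fil-vanishes (scal a M) v w = trans (*-congˡ (Fil-vanishes M v w)) (zeroʳ a)
  Fil-vanishes (resp M e) v w = trans (sym (e v w)) (Fil-vanishes M v w)

  InT⇒Fil0 : ∀ {M} → InT x M → Fil 0 M
  InT⇒Fil0 (genA g)   = resp (⟦⟧∈Fil0 _) (≋-sym (A-orbital g))
  InT⇒Fil0 (genE g)   = resp (⟦⟧∈Fil0 _) (≋-sym (E*-orbital g))
  InT⇒Fil0 one        = 𝟙∈Fil0
  InT⇒Fil0 zer        = zer
  InT⇒Fil0 (add M N)  = add (InT⇒Fil0 M) (InT⇒Fil0 N)
  InT⇒Fil0 (scal a M) = scal a (InT⇒Fil0 M)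
  InT⇒Fil0 (mul M N)  = Fil-⊠ (InT⇒Fil0 M) (InT⇒Fil0 N)
  InT⇒Fil0 (resp M e) = resp (InT⇒Fil0 M) e

  InI⇒Fil1 : ∀ {M} → InI x M → Fil 1 M
  InI⇒Fil1 (gen a b c a⊕b⊆c _ kb≈0) with k≈0⇒meets-S b kb≈0
  ... | t₀ , bt₀ , t₀∈S = resp (graded Φ lv Φ∈ (≡.subst (_≤ sumOver S lv) lv-t₀ (sumOver-≥ S lv t₀∈S)))
                               (≋-sym (B-orbital a b c))
    where
    Φ : Fin n → Orb
    Φ t = Bₒ (lookup a t) (lookup b t) (lookup c t)
    lv : Fin n → ℕ
    lv t = if does (t ≟ t₀) then 1 else 0
    lv-t₀ : lv t₀ ≡ 1
    lv-t₀ = ≡.cong (λ d → if d then 1 else 0) (does-≟-refl t₀)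
    c-t₀ : lookup a t₀ ≡ false → lookup c t₀ ≡ true
    c-t₀ at₀ =
      []=⇒lookup (a⊕b⊆c (lookup⇒[]= t₀ (a ⊕ b) (≡.trans (lookup-⊕ a b t₀) (≡.cong₂ _xor_ at₀ bt₀))))
    Φ∈ : ∀ {t} → t ∈ S → Φ t ∈J^ lv t
    Φ∈ {t} _ with t ≟ t₀
    ... | yes ≡.refl = ≡.subst (λ b → InJ (Bₒ (lookup a t₀) b (lookup c t₀))) (≡.sym bt₀) (Bₒ-radical _ _ c-t₀)
    ... | no _       = tt
  InI⇒Fil1 zer        = zer
  InI⇒Fil1 (add M N)  = add (InI⇒Fil1 M) (InI⇒Fil1 N)
  InI⇒Fil1 (scal a M) = scal a (InI⇒Fil1 M)
  InI⇒Fil1 (resp M e) = resp (InI⇒Fil1 M) e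

  InI-∑ : ∀ {a} {A : Set a} (xs : List A) (G : A → Mat) → (∀ z → InI x (G z)) →
          InI x (λ v w → ∑ xs (λ z → G z v w))
  InI-∑ []       G G∈ = resp zer (λ _ _ → refl)
  InI-∑ (z ∷ xs) G G∈ = resp (add (G∈ z) (InI-∑ xs G G∈)) (λ _ _ → refl)

  module _ (Φ : Fin n → Orb) {t₀} (t₀∈S : t₀ ∈ S) (Φt₀∈J : InJ (Φ t₀)) where

    private
      subsets = allSubsets n
      C : Fin n → Subset n → Subset n → Subset n → Carrier
      C t a b c = coef (Φ t) (lookup a t) (lookup b t) (lookup c t) (2 <ᵇ u t)
      Bᵗ : Fin n → Subset n → Subset n → Subset n → Orb
      Bᵗ t a b c = Bₒ (lookup a t) (lookup b t) (lookup c t)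

    coefficient : Subset n → Subset n → Subset n → Carrier
    coefficient a b c = ∏ (λ t → C t a b c)

    expansion : ⟦ Φ ⟧ ≋ λ v w →
                  ∑ subsets λ a → ∑ subsets λ b → ∑ subsets λ c → (coefficient a b c · B x a b c) v w
    expansion v w = begin
      ∏ (λ t → entry (Φ t) (x t) (v t) (w t))
        ≈⟨ ∏-cong (λ t → decompose (Φ t) (x t) (v t) (w t)) ⟩
      ∏ (λ t → Σ³ (λ a b c → coef (Φ t) a b c (2 <ᵇ u t) * entry (Bₒ a b c) (x t) (v t) (w t)))
        ≈⟨ ∏-Σ³ n (λ t a b c → coef (Φ t) a b c (2 <ᵇ u t) * entry (Bₒ a b c) (x t) (v t) (w t)) ⟩
      (∑ subsets λ a → ∑ subsets λ b → ∑ subsets λ c →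
         ∏ (λ t → C t a b c * entry (Bᵗ t a b c) (x t) (v t) (w t)))
        ≈⟨ ∑-cong subsets (λ a → ∑-cong subsets (λ b → ∑-cong subsets (λ c →
             trans (∏-distrib-* (λ t → C t a b c) (λ t → entry (Bᵗ t a b c) (x t) (v t) (w t)))
                   (*-congˡ (sym (B-orbital a b c v w)))))) ⟩
      (∑ subsets λ a → ∑ subsets λ b → ∑ subsets λ c → coefficient a b c * B x a b c v w) ∎

    negligible : ∀ {a b c} t → C t a b c ≈ 0# → InI x (coefficient a b c · B x a b c)
    negligible {a} {b} {c} t Ct≈0 =
      resp zer (λ v w → sym (trans (*-congʳ (∏-zero (λ t → C t a b c) t Ct≈0)) (zeroˡ _)))

    term∈I : ∀ a b c → InI x (coefficient a b c · B x a b c)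
    term∈I a b c with lookup b t₀ in bt₀
    ... | false = negligible t₀ (≡.subst₂ (λ b big → coef (Φ t₀) (lookup a t₀) b (lookup c t₀) big ≈ 0#)
                                          (≡.sym bt₀) (≡.sym (∈S⇒2<u t₀∈S))
                                          (coef-radical (Φ t₀) (lookup a t₀) (lookup c t₀) Φt₀∈J))
    ... | true with any? (λ t → admissible (lookup a t) (lookup b t) (lookup c t) (2 <ᵇ u t) Bool.≟ false)
    ...   | yes (t , inadmissible) =
            negligible t (coef-inadmissible (Φ t) (lookup a t) (lookup b t) (lookup c t) (2 <ᵇ u t) inadmissible)
    ...   | no none =
            let a⊕b⊆c , c⊆a⊙b = admissible⇒⊆ u a b c adm in
            scal (coefficient a b c) (gen a b c a⊕b⊆c c⊆a⊙b (meets-S⇒k≈0 b bt₀ t₀∈S))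
      where
      adm : ∀ t → admissible (lookup a t) (lookup b t) (lookup c t) (2 <ᵇ u t) ≡ true
      adm t with admissible (lookup a t) (lookup b t) (lookup c t) (2 <ᵇ u t) in e
      ... | true  = ≡.refl
      ... | false = ⊥-elim (none (t , e))

    ⟦Φ⟧∈I : InI x ⟦ Φ ⟧
    ⟦Φ⟧∈I = resp (InI-∑ subsets _ λ a → InI-∑ subsets _ λ b → InI-∑ subsets _ λ c → term∈I a b c)
                 (≋-sym expansion)

  Fil1⇒InI : ∀ {M} → Fil 1 M → InI x M
  Fil1⇒InI (graded Φ lv Φ∈ 1≤) with pigeonhole 0 S lv 1≤
  ... | t₀ , t₀∈S , 0<lv = ⟦Φ⟧∈I Φ t₀∈S (InJ-at (lv t₀) 0<lv (Φ∈ t₀∈S))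
    where
    InJ-at : ∀ l {φ} → 0 < l → φ ∈J^ l → InJ φ
    InJ-at (suc l) _ = ∈J^suc⇒InJ l
  Fil1⇒InI zer        = zer
  Fil1⇒InI (add M N)  = add (Fil1⇒InI M) (Fil1⇒InI N)
  Fil1⇒InI (scal a M) = scal a (Fil1⇒InI M)
  Fil1⇒InI (resp M e) = resp (Fil1⇒InI M) e

  InT-∑ : ∀ {a} {A : Set a} (xs : List A) (G : A → Mat) → (∀ z → InT x (G z)) →
          InT x (λ v w → ∑ xs (λ z → G z v w))
  InT-∑ []       G G∈ = resp zer (λ _ _ → refl)
  InT-∑ (z ∷ xs) G G∈ = resp (add (G∈ z) (InT-∑ xs G G∈)) (λ _ _ → refl)

  InI⇒InT : ∀ {M} → InI x M → InT x M
  InI⇒InT (gen a b c _ _ _) = InT-∑ (filter (λ j → ((a ⊕ c) ⊆? j) ×-dec (j ⊆? b)) (allSubsets n))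
                                    (λ j → (E* x a ⊠ A j) ⊠ E* x c) (λ j → mul (mul (genE a) (genA j)) (genE c))
  InI⇒InT zer        = zer
  InI⇒InT (add M N)  = add (InI⇒InT M) (InI⇒InT N)
  InI⇒InT (scal a M) = scal a (InI⇒InT M)
  InI⇒InT (resp M e) = resp (InI⇒InT M) e

  ideal : IsTwoSidedIdeal x (InI x)
  ideal = InI⇒InT
        , (λ M∈T N∈I → Fil1⇒InI (Fil-⊠ (InT⇒Fil0 M∈T) (InI⇒Fil1 N∈I)))
        , (λ M∈I N∈T → Fil1⇒InI (Fil-⊠ (InI⇒Fil1 M∈I) (InT⇒Fil0 N∈T)))

  prod-Fil : ∀ {Ms} → AllIn (InI x) Ms → Fil (length Ms) (prod Ms)
  prod-Fil []         = 𝟙∈Fil0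
  prod-Fil (M∈ ∷ Ms∈) = Fil-⊠ (InI⇒Fil1 M∈) (prod-Fil Ms∈)

  products-vanish : ProductsVanish (InI x) (2 ℕ.* ∣ S ∣ ℕ.+ 1)
  products-vanish Ms len Ms∈ =
    Fil-vanishes (≡.subst (λ r → Fil r (prod Ms)) (≡.trans len (ℕ.+-comm _ 1)) (prod-Fil Ms∈))

module Radical {c ℓ} (F : Field c ℓ) {n : ℕ} (u : Fin n → ℕ) (u≥2 : ∀ a → 2 ≤ u a) (x : Pt n u)
               (S : Subset n) (S⇔ : ∀ a → (a ∈ S) ⇔ Field._≈_ F (Matrices.ι F u (u a)) (Field.1# F)) where

  open Field F hiding (zero)
  open Matrices F u hiding (b2F; ι; sumL)
  open MatrixAlgebra F u
  open Filtration F u u≥2 x S S⇔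
  open import Relation.Binary.Reasoning.Setoid setoid
  open import Algebra.Properties.Ring ring using (-0#≈0#)

  private
    -+-telescope : ∀ a b c → (a + - b) + (b + - c) ≈ a + - c
    -+-telescope a b c = begin
      (a + - b) + (b + - c) ≈⟨ +-assoc a (- b) _ ⟩
      a + (- b + (b + - c)) ≈⟨ +-congˡ (+-assoc (- b) b (- c)) ⟨
      a + ((- b + b) + - c) ≈⟨ +-congˡ (+-congʳ (-‿inverseˡ b)) ⟩
      a + (0# + - c)        ≈⟨ +-congˡ (+-identityˡ (- c)) ⟩
      a + - c               ∎

  module _ {M Y} (M∈I : InI x M) (Y∈T : InT x Y) where

    private
      K = Y ⊠ M
      K∈I : InI x K
      K∈I = proj₁ (proj₂ ideal) Y∈T M∈I
      power : ℕ → Mat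
      power r = prod (List.replicate r K)

    geometric : ℕ → Mat
    geometric zero    = 𝟘
    geometric (suc r) = 𝟙 ⊞ (K ⊠ geometric r)

    geometric∈T : ∀ r → InT x (geometric r)
    geometric∈T zero    = zer
    geometric∈T (suc r) = add one (mul (mul Y∈T (InI⇒InT M∈I)) (geometric∈T r))

    geometric-telescopes : ∀ r → (geometric r ⊠ (𝟙 ⊞ (- K ᴹ))) ≋ (𝟙 ⊞ (- power r ᴹ))
    geometric-telescopes zero    = ≋-trans (⊠-zeroˡ _) (λ v w → sym (-‿inverseʳ _))
    geometric-telescopes (suc r) =
      ≋-trans (⊠-distribʳ _ _ _) (λ v w → trans (+-cong (head v w) (tail v w)) (-+-telescope _ _ _))
      where
      K∈Fil = InI⇒Fil1 K∈I
      head : (𝟙 ⊠ (𝟙 ⊞ (- K ᴹ))) ≋ (𝟙 ⊞ (- K ᴹ))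
      head = ≋-trans (⊠-distribˡ _ _ _) λ v w →
               +-cong (𝟙-⊠-Fil 𝟙∈Fil0 v w) (trans (⊠-negʳ 𝟙 K v w) (-‿cong (𝟙-⊠-Fil K∈Fil v w)))
      tail : ((K ⊠ geometric r) ⊠ (𝟙 ⊞ (- K ᴹ))) ≋ (K ⊞ (- power (suc r) ᴹ))
      tail = ≋-trans (⊠-assoc _ _ _) (≋-trans (⊠-cong ≋-refl (geometric-telescopes r))
               (≋-trans (⊠-distribˡ _ _ _) (λ v w → +-cong (Fil-⊠-𝟙 K∈Fil v w) (⊠-negʳ K (power r) v w))))

    geometric-inverts : (geometric (2 ℕ.* ∣ S ∣ ℕ.+ 1) ⊠ (𝟙 ⊞ (- K ᴹ))) ≋ 𝟙
    geometric-inverts v w = begin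
      (geometric N′ ⊠ (𝟙 ⊞ (- K ᴹ))) v w   ≈⟨ geometric-telescopes N′ v w ⟩
      𝟙 v w + - power N′ v w               ≈⟨ +-congˡ (-‿cong (products-vanish _ (List.length-replicate N′)
                                                                               (powers N′) v w)) ⟩
      𝟙 v w + - 0#                         ≈⟨ +-congˡ -0#≈0# ⟩
      𝟙 v w + 0#                           ≈⟨ +-identityʳ _ ⟩
      𝟙 v w                                ∎
      where
      N′ = 2 ℕ.* ∣ S ∣ ℕ.+ 1
      powers : ∀ r → AllIn (InI x) (List.replicate r K)
      powers zero    = []
      powers (suc r) = K∈I ∷ powers r

  radical : ∀ {M} → InI x M → InRad x M
  radical M∈I = InI⇒InT M∈I , λ Y Y∈T →
    let N′ = 2 ℕ.* ∣ S ∣ ℕ.+ 1 in geometric M∈I Y∈T N′ , geometric∈T M∈I Y∈T N′ , geometric-inverts M∈I Y∈T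

module LowerBound {c ℓ} (F : Field c ℓ) {n : ℕ} (u : Fin n → ℕ) (u≥2 : ∀ a → 2 ≤ u a) (x : Pt n u)
                  (S : Subset n) (S⇔ : ∀ a → (a ∈ S) ⇔ Field._≈_ F (Matrices.ι F u (u a)) (Field.1# F)) where

  open Field F hiding (zero)
  open BigOperators F
  open OrbitAlgebra F
  open Matrices F u hiding (b2F; ι; sumL)
  open MatrixAlgebra F u
  open Tensor F u x
  open Filtration F u u≥2 x S S⇔
  open import Relation.Binary.Reasoning.Setoid setoid

  G₁ G₂ : Fin n → Mat
  G₁ t = B x S ⁅ t ⁆ (S ─ ⁅ t ⁆)
  G₂ t = B x (S ─ ⁅ t ⁆) ⁅ t ⁆ S

  private
    ⁅⁆⊆S : ∀ {t} → t ∈ S → ∀ i → lookup ⁅ t ⁆ i ≡ true → lookup S i ≡ true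
    ⁅⁆⊆S {t} t∈S i e with i ≟ t | ≡.trans (≡.sym (lookup-⁅⁆ t i)) e
    ... | yes ≡.refl | _ = []=⇒lookup t∈S

    k⁅⁆≈0 : ∀ {t} → t ∈ S → Matrices.ι F u (k x ⁅ t ⁆) ≈ 0#
    k⁅⁆≈0 {t} = meets-S⇒k≈0 ⁅ t ⁆ (≡.trans (lookup-⁅⁆ t t) (does-≟-refl t))

    G₁-admissible : ∀ s e big → (e ≡ true → s ≡ true) → admissible s e (s ∧ not e) big ≡ true
    G₁-admissible true  false _ _   = ≡.refl
    G₁-admissible true  true  _ _   = ≡.refl
    G₁-admissible false false _ _   = ≡.refl
    G₁-admissible false true  _ e⇒s = contradiction (e⇒s ≡.refl) λ ()

    G₂-admissible : ∀ s e big → (e ≡ true → s ≡ true) → admissible (s ∧ not e) e s big ≡ true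
    G₂-admissible true  false _ _   = ≡.refl
    G₂-admissible true  true  _ _   = ≡.refl
    G₂-admissible false false _ _   = ≡.refl
    G₂-admissible false true  _ e⇒s = contradiction (e⇒s ≡.refl) λ ()

  G₁∈I : ∀ {t} → t ∈ S → InI x (G₁ t)
  G₁∈I {t} t∈S = gen S ⁅ t ⁆ (S ─ ⁅ t ⁆) ⊕⊆ ⊆⊙ (k⁅⁆≈0 t∈S)
    where
    adm : ∀ i → admissible (lookup S i) (lookup ⁅ t ⁆ i) (lookup (S ─ ⁅ t ⁆) i) (2 <ᵇ u i) ≡ true
    adm i = ≡.subst (λ c → admissible (lookup S i) (lookup ⁅ t ⁆ i) c (2 <ᵇ u i) ≡ true) (≡.sym (lookup-─ S ⁅ t ⁆ i))
                    (G₁-admissible _ _ _ (⁅⁆⊆S t∈S i))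
    ⊕⊆ = proj₁ (admissible⇒⊆ u S ⁅ t ⁆ (S ─ ⁅ t ⁆) adm)
    ⊆⊙ = proj₂ (admissible⇒⊆ u S ⁅ t ⁆ (S ─ ⁅ t ⁆) adm)

  G₂∈I : ∀ {t} → t ∈ S → InI x (G₂ t)
  G₂∈I {t} t∈S = gen (S ─ ⁅ t ⁆) ⁅ t ⁆ S ⊕⊆ ⊆⊙ (k⁅⁆≈0 t∈S)
    where
    adm : ∀ i → admissible (lookup (S ─ ⁅ t ⁆) i) (lookup ⁅ t ⁆ i) (lookup S i) (2 <ᵇ u i) ≡ true
    adm i = ≡.subst (λ a → admissible a (lookup ⁅ t ⁆ i) (lookup S i) (2 <ᵇ u i) ≡ true) (≡.sym (lookup-─ S ⁅ t ⁆ i))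
                    (G₂-admissible _ _ _ (⁅⁆⊆S t∈S i))
    ⊕⊆ = proj₁ (admissible⇒⊆ u (S ─ ⁅ t ⁆) ⁅ t ⁆ S adm)
    ⊆⊙ = proj₂ (admissible⇒⊆ u (S ─ ⁅ t ⁆) ⁅ t ⁆ S adm)

  pairs : List (Fin n) → List Mat
  pairs []       = []
  pairs (t ∷ ts) = G₁ t ∷ G₂ t ∷ pairs ts

  pairs∈I : ∀ {ts} → All (_∈ S) ts → AllIn (InI x) (pairs ts)
  pairs∈I []           = []
  pairs∈I (t∈S ∷ ts∈S) = G₁∈I t∈S ∷ G₂∈I t∈S ∷ pairs∈I ts∈S

  length-pairs : ∀ ts → length (pairs ts) ≡ 2 ℕ.* length ts
  length-pairs []       = ≡.refl
  length-pairs (t ∷ ts) = ≡.trans (≡.cong (λ l → suc (suc l)) (length-pairs ts)) (≡.sym (ℕ.*-suc 2 (length ts)))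

  pairsₒ : List (Fin n) → (t : Fin n) → Orb
  pairsₒ []       t′ = Aₒ false
  pairsₒ (t ∷ ts) t′ = pairₒ (others (u t′)) (lookup S t′) (does (t′ ≟ t)) (pairsₒ ts t′)

  ⟦⟧-cong : ∀ {Φ Φ′} → (∀ t → Φ t ≡ Φ′ t) → ⟦ Φ ⟧ ≋ ⟦ Φ′ ⟧
  ⟦⟧-cong Φ≡Φ′ = tensor-cong (λ t p q → reflexive (≡.cong (λ φ → entry φ (x t) p q) (Φ≡Φ′ t)))

  prod-pairs : ∀ ts → prod (pairs ts) ≋ ⟦ pairsₒ ts ⟧
  prod-pairs []       = 𝟙-orbital
  prod-pairs (t ∷ ts) =
    ≋-trans (⊠-cong (B-orbital _ _ _) (⊠-cong (B-orbital _ _ _) (prod-pairs ts)))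
    (≋-trans (⊠-cong ≋-refl (⟦⟧-⊠ _ (pairsₒ ts)))
    (≋-trans (⟦⟧-⊠ _ _) (⟦⟧-cong local)))
    where
    local : ∀ t′ → _ ≡ pairsₒ (t ∷ ts) t′
    local t′ = ≡.cong₂ (λ e d → Bₒ s e d ⋆[ others (u t′) ] (Bₒ d e s ⋆[ others (u t′) ] pairsₒ ts t′))
                       (lookup-⁅⁆ t t′)
                       (≡.trans (lookup-─ S ⁅ t ⁆ t′) (≡.cong (λ e → s ∧ not e) (lookup-⁅⁆ t t′)))
      where s = lookup S t′

  pairsₒ-outside : ∀ {t′} → lookup S t′ ≡ false → ∀ ts → xx (pairsₒ ts t′) ≈ 1#
  pairsₒ-outside         _    []       = refl
  pairsₒ-outside {t′} t′∉S (t ∷ ts) rewrite t′∉S =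
    trans (pairₒ-outside (others (u t′)) (does (t′ ≟ t)) (pairsₒ ts t′)) (pairsₒ-outside t′∉S ts)

  pairsₒ-untouched : ∀ {t′} → lookup S t′ ≡ true → ∀ ts → occurrences t′ ts ≡ 0 →
                     diag (pairsₒ ts t′) ≈ 1# × ones (pairsₒ ts t′) ≈ 0#
  pairsₒ-untouched         _    []       _ = refl , refl
  pairsₒ-untouched {t′} t′∈S (t ∷ ts) occ rewrite t′∈S with does (t′ ≟ t)
  ... | false = let d , o   = pairsₒ-untouched t′∈S ts occ
                    d′ , o′ = pairₒ-away (others (u t′)) (pairsₒ ts t′)
                in trans d′ d , trans o′ o

  pairsₒ-touched : ∀ {t′} → lookup S t′ ≡ true → ∀ ts → occurrences t′ ts ≡ 1 →
                   diag (pairsₒ ts t′) ≈ 0# × ones (pairsₒ ts t′) ≈ 1#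
  pairsₒ-touched {t′} t′∈S (t ∷ ts) occ rewrite t′∈S with does (t′ ≟ t)
  ... | true  = let d , o   = pairsₒ-untouched t′∈S ts (ℕ.suc-injective occ)
                    d′ , o′ = pairₒ-at (others (u t′)) (pairsₒ ts t′)
                in d′ , trans o′ (trans (+-cong d (trans (*-congˡ o) (zeroʳ _))) (+-identityʳ 1#))
  ... | false = let d , o   = pairsₒ-touched t′∈S ts occ
                    d′ , o′ = pairₒ-away (others (u t′)) (pairsₒ ts t′)
                in trans d′ d , trans o′ o

  witness : Pt n u
  witness t = pick (lookup S t)
    where
    pick : Bool → Fin (u t)
    pick true  = away-point (u≥2 t) (x t)
    pick false = x t

  prod-pairs-witness : prod (pairs (elements S)) witness witness ≈ 1#
  prod-pairs-witness = trans (prod-pairs (elements S) witness witness) (∏-one _ diagonal)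
    where
    diagonal : ∀ t → entry (pairsₒ (elements S) t) (x t) (witness t) (witness t) ≈ 1#
    diagonal t with lookup S t in e
    ... | false = trans (reflexive (entry-at (pairsₒ (elements S) t) (x t))) (pairsₒ-outside e (elements S))
    ... | true  = let d , o = pairsₒ-touched e (elements S) (occurrences-elements S (lookup⇒[]= t S e)) in
                  trans (entry-away-point (pairsₒ (elements S) t) (u≥2 t) (x t)) (trans (+-cong d o) (+-identityˡ 1#))

  AllIn-take : ∀ h {Ms} → AllIn (InI x) Ms → AllIn (InI x) (List.take h Ms)
  AllIn-take zero    _          = []
  AllIn-take (suc h) []         = []
  AllIn-take (suc h) (M∈ ∷ Ms∈) = M∈ ∷ AllIn-take h Ms∈

  AllIn-drop : ∀ h {Ms} → AllIn (InI x) Ms → AllIn (InI x) (List.drop h Ms)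
  AllIn-drop zero    Ms∈       = Ms∈
  AllIn-drop (suc h) []        = []
  AllIn-drop (suc h) (_ ∷ Ms∈) = AllIn-drop h Ms∈

  prod-++ : ∀ {Ms Ns} → AllIn (InI x) Ms → AllIn (InI x) Ns → prod (Ms List.++ Ns) ≋ (prod Ms ⊠ prod Ns)
  prod-++ []        Ns∈ = ≋-sym (𝟙-⊠-Fil (prod-Fil Ns∈))
  prod-++ (_ ∷ Ms∈) Ns∈ = ≋-trans (⊠-cong ≋-refl (prod-++ Ms∈ Ns∈)) (≋-sym (⊠-assoc _ _ _))

  ProductsVanish-mono : ∀ {h H} → h ≤ H → ProductsVanish (InI x) h → ProductsVanish (InI x) H
  ProductsVanish-mono {h} h≤H vanish Ms len Ms∈ =
    ≋-trans (≡⇒≋ (≡.cong prod (≡.sym (List.take++drop≡id h Ms))))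
    (≋-trans (prod-++ (AllIn-take h Ms∈) (AllIn-drop h Ms∈))
    (≋-trans (⊠-cong (vanish (List.take h Ms) length-take (AllIn-take h Ms∈)) ≋-refl)
             (⊠-zeroˡ _)))
    where
    length-take : length (List.take h Ms) ≡ h
    length-take = ≡.trans (List.length-take h Ms) (≡.trans (≡.cong (h ℕ.⊓_) len) (ℕ.m≤n⇒m⊓n≡m h≤H))

  products-survive : ∀ h → h < 2 ℕ.* ∣ S ∣ ℕ.+ 1 → ¬ ProductsVanish (InI x) h
  products-survive h h<2N+1 vanish = 1≉0 (begin
    1#                                        ≈⟨ prod-pairs-witness ⟨
    prod (pairs (elements S)) witness witness ≈⟨ ProductsVanish-mono h≤2N vanish _ length-2N Ms∈ witness witness ⟩
    0#                                        ∎)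
    where
    h≤2N : h ≤ 2 ℕ.* ∣ S ∣
    h≤2N = ℕ.≤-pred (ℕ.≤-trans h<2N+1 (ℕ.≤-reflexive (ℕ.+-comm _ 1)))
    length-2N : length (pairs (elements S)) ≡ 2 ℕ.* ∣ S ∣
    length-2N = ≡.trans (length-pairs (elements S)) (≡.cong (2 ℕ.*_) (length-elements S))
    Ms∈ = pairs∈I (elements⊆ S)

open import Data.Nat using (_+_; _*_)

lemma7p11 : ∀ {c ℓ} (F : Field c ℓ) (n : ℕ) → 1 ≤ n → (u : Fin n → ℕ) →
    (∀ a → 2 ≤ u a) →
    (x : Matrices.X F u) →
    (S : Subset n) → (∀ a → (a ∈ S) ⇔ Field._≈_ F (Matrices.ι F u (u a)) (Field.1# F)) →
    let open Matrices F u
        N = ∣ S ∣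
    in ProductsVanish (InI x) (2 * N + 1)
       × IsTwoSidedIdeal x (InI x)
       × NilpotencyIndex (InI x) (2 * N + 1)
       × (∀ {M} → InI x M → InRad x M)
lemma7p11 F n _ u u≥2 x S S⇔ =
  products-vanish , ideal , (ℕ.m≤n+m 1 (2 * ∣ S ∣) , products-vanish , λ h _ → products-survive h) , radical
  where
  open Filtration F u u≥2 x S S⇔
  open Radical F u u≥2 x S S⇔
  open LowerBound F u u≥2 x S S⇔
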